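{- Let $n=n_1+\cdots+n_r$ with $r\ge1$ and positive integers $n_i$, $N_0=0$, $N_i=n_1+\cdots+n_i$, and let $\Delta\subset\mathbb{R}^{n+1}$ be the convex hull of $V_0,\dots,V_{n+r+1}$ as in the context with all $b_l=1$. Then for every $k\ge0$ the Hodge number $H_\Delta(k)$ equals the coefficient of $x^k$ in $G_1(x)=\prod_{i=1}^r(1+x+\cdots+x^{n_i})$. In particular $H_\Delta(0)=1$, $H_\Delta(1)=r$, and $H_\Delta(k)=H_\Delta(n-k)$ for $0\le k\le n$.
   Context: $V_0=0$; $V_1,\dots,V_{n+1}$ are the standard basis vectors $e_1,\dots,e_{n+1}$ of $\mathbb{R}^{n+1}$; for $1\le i\le r$, $V_{n+1+i}=e_{n+1}-\sum_{l=N_{i-1}+1}^{N_i}e_l$. Here the denominator is $D=1$. The weight $w(u)$ of $u\in\mathbb{Z}^{n+1}$ is the least $c\ge0$ with $u\in c\Delta$ ($\infty$ if none); $W_\Delta(k)=\#\{u\in\mathbb{Z}^{n+1}:w(u)=k\}$ and $H_\Delta(k)=\sum_{i=0}^{n+1}(-1)^i\binom{n+1}{i}W_\Delta(k-i)$ (with $W_\Delta$ of a negative argument equal to $0$). -}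

module Defs where

open import Data.Nat as ℕ using (ℕ; zero; suc; _∸_; _≡ᵇ_; _<ᵇ_; _≤ᵇ_)
open import Data.Bool using (Bool; true; false; if_then_else_; _∧_)
open import Data.Integer as ℤ using (ℤ; +_)
open import Data.Rational as ℚ using (ℚ; 0ℚ)
open import Data.Fin using (Fin; toℕ) renaming (zero to fzero; suc to fsuc)
open import Data.Vec as Vec using (Vec; lookup)
open import Data.List as List using (List; []; _∷_; length; upTo)
open import Data.List.Relation.Unary.Unique.Propositional using (Unique)
open import Data.List.Membership.Propositional using (_∈_)
open import Data.Nat.Combinatorics using (_C_)
open import Data.Nat.ListAction using () renaming (sum to sumℕ)
open import Data.Product using (Σ; _×_)
open import Function.Bundles using (_⇔_)
open import Relation.Binary.PropositionalEquality using (_≡_)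
open import Relation.Nullary using (¬_)

Σℚ : ∀ {m} → (Fin m → ℚ) → ℚ
Σℚ {zero}  f = 0ℚ
Σℚ {suc m} f = f fzero ℚ.+ Σℚ (λ i → f (fsuc i))

total : ∀ {r} → Vec ℕ r → ℕ
total ns = sumℕ (Vec.toList ns)

partialSum : ∀ {r} → Vec ℕ r → ℕ → ℕ
partialSum ns i = sumℕ (List.take i (Vec.toList ns))

ind : Bool → ℤ
ind true  = + 1
ind false = + 0

-- Coordinate l (1-based, 1 ≤ l ≤ n+1) of the vertex V_j (0 ≤ j ≤ n+r+1):
--   V_0 = 0; V_j = e_j for 1 ≤ j ≤ n+1;
--   V_{n+1+i} = e_{n+1} - Σ_{l=N_{i-1}+1}^{N_i} e_l  for 1 ≤ i ≤ r.
vertexCoord : ∀ {r} → Vec ℕ r → ℕ → ℕ → ℤ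
vertexCoord ns j l =
  if j ≡ᵇ 0 then + 0
  else if j ≤ᵇ suc n then ind (l ≡ᵇ j)
  else ind (l ≡ᵇ suc n) ℤ.- ind ((partialSum ns (i ∸ 1) <ᵇ l) ∧ (l ≤ᵇ partialSum ns i))
  where
    n = total ns
    i = j ∸ suc n

Point : ∀ {r} → Vec ℕ r → Set
Point ns = Vec ℤ (suc (total ns))

toℚ : ℤ → ℚ
toℚ z = z ℚ./ 1

-- u ∈ cΔ, where Δ = conv(V_0,…,V_{n+r+1}):
-- u = Σ_j λ_j V_j with λ_j ≥ 0 and Σ_j λ_j = c.
InScaled : ∀ {r} (ns : Vec ℕ r) → ℚ → Point ns → Set
InScaled {r} ns c u =
  Σ (Fin (suc (suc (total ns ℕ.+ r))) → ℚ) λ λs →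
    (∀ j → 0ℚ ℚ.≤ λs j) ×
    (Σℚ λs ≡ c) ×
    (∀ (l : Fin (suc (total ns))) →
       toℚ (lookup u l) ≡ Σℚ (λ j → λs j ℚ.* toℚ (vertexCoord ns (toℕ j) (suc (toℕ l)))))

HasWeight : ∀ {r} (ns : Vec ℕ r) → Point ns → ℕ → Set
HasWeight ns u k =
  InScaled ns (toℚ (+ k)) u ×
  (∀ (c : ℚ) → 0ℚ ℚ.≤ c → c ℚ.< toℚ (+ k) → ¬ InScaled ns c u)

HasCard : {A : Set} → (A → Set) → ℕ → Set
HasCard {A} P m =
  Σ (List A) λ xs → Unique xs × (∀ a → (a ∈ xs) ⇔ P a) × (length xs ≡ m)

Hodge : ℕ → (ℕ → ℕ) → ℕ → ℤ
Hodge n W k = List.foldr ℤ._+_ (+ 0) (List.map term (upTo (suc (suc n))))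
  where
    sign : ℕ → ℤ
    sign i = if (i ℕ.% 2) ≡ᵇ 0 then + 1 else ℤ.- (+ 1)
    Wshift : ℕ → ℕ
    Wshift i = if i ≤ᵇ k then W (k ∸ i) else 0
    term : ℕ → ℤ
    term i = sign i ℤ.* (+ ((suc n C i) ℕ.* Wshift i))

-- Polynomials with ℕ coefficients as coefficient lists (constant term first).
polyAdd : List ℕ → List ℕ → List ℕ
polyAdd [] q = q
polyAdd (a ∷ p) [] = a ∷ p
polyAdd (a ∷ p) (b ∷ q) = (a ℕ.+ b) ∷ polyAdd p q

polyMul : List ℕ → List ℕ → List ℕ
polyMul [] q = []
polyMul (a ∷ p) q = polyAdd (List.map (a ℕ.*_) q) (0 ∷ polyMul p q)

coeff : List ℕ → ℕ → ℕ
coeff [] k = 0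
coeff (a ∷ p) zero = a
coeff (a ∷ p) (suc k) = coeff p k

geomPoly : ℕ → List ℕ
geomPoly m = List.replicate (suc m) 1

G₁ : ∀ {r} → Vec ℕ r → List ℕ
G₁ ns = List.foldr (λ m p → polyMul (geomPoly m) p) (1 ∷ []) (Vec.toList ns)

-- Write a point as u = (x₁, …, x_r, z) with blocks xᵢ ∈ ℤ^{nᵢ}, and let dᵢ = max(0, −min xᵢ) be the deficit of
-- block i. Then u lies in some dilate of Δ iff z ≥ Σ dᵢ, and in that case
--   w(u) = Σᵢ (Σ xᵢ + (nᵢ + 1) dᵢ) + z − Σᵢ dᵢ.
-- An explicit nonnegative integer combination of vertices shows that w(u) is at most this value; two linear
-- functionals bounded by 1 (resp. 0) on all vertices give the matching lower bound and the admissibility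
-- condition (weak LP duality).
-- Counting block by block: the v ∈ ℤᵐ with Σ v + (m + 1) d = j are the v ≥ 0 with Σ v = j together with the
-- y − d·(1, …, 1) for y ≥ 0 having a zero coordinate and Σ y = j − d, so their generating function is
-- (1 + x + ⋯ + xᵐ)/(1 − x)ᵐ; the last coordinate contributes 1/(1 − x). Hence Σₖ W(k) xᵏ = G₁(x)/(1 − x)ⁿ⁺¹,
-- and H_Δ, which multiplies by (1 − x)ⁿ⁺¹, returns the coefficients of G₁. The remaining claims are properties
-- of G₁, which is palindromic as a product of palindromic polynomials.

module Submission where

import Algebra.Properties.CommutativeSemigroup as CommutativeSemigroupProperties
open import Algebra.Bundles using (CommutativeMonoid)
open import Data.Bool using (Bool; true; false; if_then_else_; _∧_)
open import Data.Empty using (⊥; ⊥-elim)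
open import Data.Fin using (Fin; toℕ) renaming (zero to fzero; suc to fsuc)
import Data.Fin.Properties as FinP
open import Data.Integer as ℤ using (ℤ; +_)
import Data.Integer.Properties as ℤP
open import Data.Integer.Tactic.RingSolver using (solve-∀)
open import Data.List as List using (List; []; _∷_; _++_; concatMap; length; upTo; applyUpTo)
open import Data.List.Membership.Propositional using (_∈_; find; lose)
open import Data.List.Membership.Propositional.Properties
  using (∈-++⁺ˡ; ∈-++⁺ʳ; ∈-++⁻; ∈-map⁺; ∈-map⁻; ∈-upTo⁺; ∈-upTo⁻; ∈-concatMap⁺; ∈-concatMap⁻)
open import Data.List.Properties using (length-++; length-map)
open import Data.List.Relation.Unary.All as All using (All; []; _∷_)
import Data.List.Relation.Unary.All.Properties as AllP
open import Data.List.Relation.Unary.AllPairs using ([]; _∷_)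
open import Data.List.Relation.Unary.Any using (here; there)
open import Data.List.Relation.Unary.Unique.Propositional using (Unique)
open import Data.List.Relation.Unary.Unique.Propositional.Properties using (++⁺; map⁺; upTo⁺)
open import Data.Maybe as Maybe using (Maybe; just; nothing)
open import Data.Nat as ℕ using (ℕ; zero; suc; _+_; _*_; _∸_; _≤_; _≡ᵇ_; _<ᵇ_; _≤ᵇ_; _%_; z≤n; s≤s)
import Data.Nat.Coprimality as Coprime
open import Data.Nat.Combinatorics using (_C_; nCk+nC[k+1]≡[n+1]C[k+1]; k>n⇒nCk≡0)
import Data.Nat.Properties as ℕP
open import Data.Product using (Σ; ∃; _×_; _,_; proj₁; proj₂)
open import Data.Rational as ℚ using (ℚ; 0ℚ; mkℚ; _/_)
import Data.Rational.Properties as ℚP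
open import Data.Sum using (_⊎_; inj₁; inj₂)
open import Data.Vec as Vec using (Vec; []; _∷_; lookup)
import Data.Vec.Properties as VecP
open import Defs
open import Function using (_∘_)
open import Function.Bundles using (_⇔_; mk⇔; Equivalence)
open import Relation.Binary.Definitions using (tri<; tri≈; tri>)
open import Relation.Binary.PropositionalEquality
open import Relation.Nullary using (¬_; yes; no)
open import Relation.Nullary.Decidable using (proof; ⌊_⌋)
open import Relation.Nullary.Reflects using (Reflects; ofʸ; ofⁿ)

reflects-true : ∀ {P : Set} {b} → Reflects P b → P → b ≡ true
reflects-true (ofʸ _) _ = refl
reflects-true (ofⁿ ¬p) p = ⊥-elim (¬p p)

reflects-false : ∀ {P : Set} {b} → Reflects P b → ¬ P → b ≡ false
reflects-false (ofʸ p) ¬p = ⊥-elim (¬p p)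
reflects-false (ofⁿ _) _ = refl

reflects-agree : ∀ {P Q : Set} {b c} → Reflects P b → Reflects Q c → (P → Q) → (Q → P) → b ≡ c
reflects-agree (ofʸ p) q P⇒Q Q⇒P = sym (reflects-true q (P⇒Q p))
reflects-agree (ofⁿ ¬p) q P⇒Q Q⇒P = sym (reflects-false q (λ x → ¬p (Q⇒P x)))

≡ᵇ-reflects-≡ : ∀ m n → Reflects (m ≡ n) (m ≡ᵇ n)
≡ᵇ-reflects-≡ m n = proof (m ℕ.≟ n)

≡ᵇ-false : ∀ {m n} → m ≢ n → (m ≡ᵇ n) ≡ false
≡ᵇ-false = reflects-false (≡ᵇ-reflects-≡ _ _)

<ᵇ-true : ∀ {m n} → m ℕ.< n → (m <ᵇ n) ≡ true
<ᵇ-true = reflects-true (ℕP.<ᵇ-reflects-< _ _)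

<ᵇ-false : ∀ {m n} → n ℕ.≤ m → (m <ᵇ n) ≡ false
<ᵇ-false n≤m = reflects-false (ℕP.<ᵇ-reflects-< _ _) (ℕP.≤⇒≯ n≤m)

≤ᵇ-true : ∀ {m n} → m ℕ.≤ n → (m ≤ᵇ n) ≡ true
≤ᵇ-true = reflects-true (ℕP.≤ᵇ-reflects-≤ _ _)

≤ᵇ-false : ∀ {m n} → n ℕ.< m → (m ≤ᵇ n) ≡ false
≤ᵇ-false n<m = reflects-false (ℕP.≤ᵇ-reflects-≤ _ _) (ℕP.<⇒≱ n<m)

≡ᵇ-sym : ∀ m n → (m ≡ᵇ n) ≡ (n ≡ᵇ m)
≡ᵇ-sym m n = reflects-agree (≡ᵇ-reflects-≡ m n) (≡ᵇ-reflects-≡ n m) sym sym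

+-≡ᵇ : ∀ m a b → (m ℕ.+ a ≡ᵇ m ℕ.+ b) ≡ (a ≡ᵇ b)
+-≡ᵇ m a b = reflects-agree (≡ᵇ-reflects-≡ _ _) (≡ᵇ-reflects-≡ a b) (ℕP.+-cancelˡ-≡ m a b) (cong (m ℕ.+_))

+-<ᵇ : ∀ m a b → (m ℕ.+ a <ᵇ m ℕ.+ b) ≡ (a <ᵇ b)
+-<ᵇ m a b = reflects-agree (ℕP.<ᵇ-reflects-< _ _) (ℕP.<ᵇ-reflects-< a b) (ℕP.+-cancelˡ-< m a b) (ℕP.+-monoʳ-< m)

+-≤ᵇ : ∀ m a b → (m ℕ.+ a ≤ᵇ m ℕ.+ b) ≡ (a ≤ᵇ b)
+-≤ᵇ m a b = reflects-agree (ℕP.≤ᵇ-reflects-≤ _ _) (ℕP.≤ᵇ-reflects-≤ a b) (ℕP.+-cancelˡ-≤ m a b) (ℕP.+-monoʳ-≤ m)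

kronecker : ℕ → ℕ → ℤ
kronecker l t = ind (l ≡ᵇ t)

kronecker-sym : ∀ l t → kronecker l t ≡ kronecker t l
kronecker-sym l t = cong ind (≡ᵇ-sym l t)

module ℤ+ = CommutativeSemigroupProperties ℤP.+-commutativeSemigroup
module ℚ+ = CommutativeSemigroupProperties (CommutativeMonoid.commutativeSemigroup ℚP.+-0-commutativeMonoid)
module ℚ* = CommutativeSemigroupProperties (CommutativeMonoid.commutativeSemigroup ℚP.*-1-commutativeMonoid)
module ℕ+ = CommutativeSemigroupProperties ℕP.+-commutativeSemigroup
module ℤ* = CommutativeSemigroupProperties ℤP.*-commutativeSemigroup

∑ℤ : ℕ → (ℕ → ℤ) → ℤ
∑ℤ zero f = + 0
∑ℤ (suc n) f = f 0 ℤ.+ ∑ℤ n (λ i → f (suc i))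

∑ℤ-cong : ∀ n {f g : ℕ → ℤ} → (∀ i → i ℕ.< n → f i ≡ g i) → ∑ℤ n f ≡ ∑ℤ n g
∑ℤ-cong zero e = refl
∑ℤ-cong (suc n) e = cong₂ ℤ._+_ (e 0 (s≤s z≤n)) (∑ℤ-cong n (λ i p → e (suc i) (s≤s p)))

∑ℤ-split : ∀ m k (f : ℕ → ℤ) → ∑ℤ (m ℕ.+ k) f ≡ ∑ℤ m f ℤ.+ ∑ℤ k (λ i → f (m ℕ.+ i))
∑ℤ-split zero k f = sym (ℤP.+-identityˡ _)
∑ℤ-split (suc m) k f = trans (cong (ℤ._+_ (f 0)) (∑ℤ-split m k (λ i → f (suc i)))) (sym (ℤP.+-assoc (f 0) _ _))

∑ℤ-snoc : ∀ n (f : ℕ → ℤ) → ∑ℤ (suc n) f ≡ ∑ℤ n f ℤ.+ f n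
∑ℤ-snoc zero f = ℤP.+-comm (f 0) (+ 0)
∑ℤ-snoc (suc n) f = trans (cong (ℤ._+_ (f 0)) (∑ℤ-snoc n (λ i → f (suc i)))) (sym (ℤP.+-assoc (f 0) _ _))

∑ℤ-distrib-+ : ∀ n (f g : ℕ → ℤ) → ∑ℤ n (λ i → f i ℤ.+ g i) ≡ ∑ℤ n f ℤ.+ ∑ℤ n g
∑ℤ-distrib-+ zero f g = refl
∑ℤ-distrib-+ (suc n) f g =
  trans (cong (ℤ._+_ (f 0 ℤ.+ g 0)) (∑ℤ-distrib-+ n _ _)) (ℤ+.interchange (f 0) (g 0) _ _)

∑ℤ-*ˡ : ∀ n (c : ℤ) (f : ℕ → ℤ) → ∑ℤ n (λ i → c ℤ.* f i) ≡ c ℤ.* ∑ℤ n f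
∑ℤ-*ˡ zero c f = sym (ℤP.*-zeroʳ c)
∑ℤ-*ˡ (suc n) c f = trans (cong (ℤ._+_ (c ℤ.* f 0)) (∑ℤ-*ˡ n c _)) (sym (ℤP.*-distribˡ-+ c (f 0) _))

∑ℤ-neg : ∀ n (f : ℕ → ℤ) → ∑ℤ n (λ i → ℤ.- f i) ≡ ℤ.- ∑ℤ n f
∑ℤ-neg zero f = refl
∑ℤ-neg (suc n) f = trans (cong (ℤ._+_ (ℤ.- f 0)) (∑ℤ-neg n _)) (sym (ℤP.neg-distrib-+ (f 0) _))

∑ℤ-zero : ∀ n → ∑ℤ n (λ _ → + 0) ≡ + 0
∑ℤ-zero zero = refl
∑ℤ-zero (suc n) = trans (ℤP.+-identityˡ _) (∑ℤ-zero n)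

∑ℤ-const : ∀ n c → ∑ℤ n (λ _ → c) ≡ + n ℤ.* c
∑ℤ-const zero c = sym (ℤP.*-zeroˡ c)
∑ℤ-const (suc n) c = trans (cong (ℤ._+_ c) (∑ℤ-const n c)) (sym (ℤP.suc-* (+ n) c))

∑ℤ-mono-≤ : ∀ n {f g : ℕ → ℤ} → (∀ i → i ℕ.< n → f i ℤ.≤ g i) → ∑ℤ n f ℤ.≤ ∑ℤ n g
∑ℤ-mono-≤ zero e = ℤP.≤-refl
∑ℤ-mono-≤ (suc n) e = ℤP.+-mono-≤ (e 0 (s≤s z≤n)) (∑ℤ-mono-≤ n (λ i p → e (suc i) (s≤s p)))

∑ℤ-nonNeg : ∀ n (f : ℕ → ℤ) → (∀ i → i ℕ.< n → + 0 ℤ.≤ f i) → + 0 ℤ.≤ ∑ℤ n f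
∑ℤ-nonNeg n f p = subst (ℤ._≤ ∑ℤ n f) (∑ℤ-zero n) (∑ℤ-mono-≤ n p)

∑ℤ-kronecker : ∀ n t (f : ℕ → ℤ) → t ℕ.< n → ∑ℤ n (λ i → f i ℤ.* kronecker i t) ≡ f t
∑ℤ-kronecker (suc n) zero f _ =
  trans (cong₂ ℤ._+_ (ℤP.*-identityʳ (f 0)) (trans (∑ℤ-cong n (λ i _ → ℤP.*-zeroʳ (f (suc i)))) (∑ℤ-zero n)))
        (ℤP.+-identityʳ (f 0))
∑ℤ-kronecker (suc n) (suc t) f (s≤s t<n) =
  trans (cong (ℤ._+ ∑ℤ n (λ i → f (suc i) ℤ.* kronecker i t)) (ℤP.*-zeroʳ (f 0)))
        (trans (ℤP.+-identityˡ _) (∑ℤ-kronecker n t (λ i → f (suc i)) t<n))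

∑ℤ-kronecker-outside : ∀ n t (f : ℕ → ℤ) → n ℕ.≤ t → ∑ℤ n (λ i → f i ℤ.* kronecker i t) ≡ + 0
∑ℤ-kronecker-outside n t f n≤t = trans (∑ℤ-cong n vanish) (∑ℤ-zero n)
  where
  vanish : ∀ i → i ℕ.< n → f i ℤ.* kronecker i t ≡ + 0
  vanish i i<n = trans (cong (λ b → f i ℤ.* ind b) (≡ᵇ-false (λ i≡t → ℕP.<-irrefl i≡t (ℕP.<-≤-trans i<n n≤t))))
                       (ℤP.*-zeroʳ (f i))

∑ℤ-kronecker′ : ∀ n t (f : ℕ → ℤ) → t ℕ.< n → ∑ℤ n (λ i → f i ℤ.* kronecker t i) ≡ f t
∑ℤ-kronecker′ n t f t<n = trans (∑ℤ-cong n (λ i _ → cong (f i ℤ.*_) (kronecker-sym t i))) (∑ℤ-kronecker n t f t<n)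

∑ℤ-kronecker′-outside : ∀ n t (f : ℕ → ℤ) → n ℕ.≤ t → ∑ℤ n (λ i → f i ℤ.* kronecker t i) ≡ + 0
∑ℤ-kronecker′-outside n t f n≤t =
  trans (∑ℤ-cong n (λ i _ → cong (f i ℤ.*_) (kronecker-sym t i))) (∑ℤ-kronecker-outside n t f n≤t)

*-nonNeg : ∀ {a b} → + 0 ℤ.≤ a → + 0 ℤ.≤ b → + 0 ℤ.≤ a ℤ.* b
*-nonNeg {a} {b} 0≤a 0≤b =
  subst (ℤ._≤ a ℤ.* b) (ℤP.*-zeroʳ a) (ℤP.*-monoˡ-≤-nonNeg a {{ℤ.nonNegative 0≤a}} 0≤b)

toℚ-mkℚ : ∀ z → toℚ z ≡ mkℚ z 0 (Coprime.sym (Coprime.1-coprimeTo _))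
toℚ-mkℚ z = ℚP.↥p/↧p≡p (mkℚ z 0 (Coprime.sym (Coprime.1-coprimeTo _)))

toℚ-+ : ∀ a b → toℚ (a ℤ.+ b) ≡ toℚ a ℚ.+ toℚ b
toℚ-+ a b rewrite toℚ-mkℚ a | toℚ-mkℚ b =
  cong (_/ 1) (sym (cong₂ ℤ._+_ (ℤP.*-identityʳ a) (ℤP.*-identityʳ b)))

toℚ-* : ∀ a b → toℚ (a ℤ.* b) ≡ toℚ a ℚ.* toℚ b
toℚ-* a b rewrite toℚ-mkℚ a | toℚ-mkℚ b = refl

toℚ-mono-≤ : ∀ {a b} → a ℤ.≤ b → toℚ a ℚ.≤ toℚ b
toℚ-mono-≤ {a} {b} a≤b rewrite toℚ-mkℚ a | toℚ-mkℚ b =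
  ℚ.*≤* (subst₂ ℤ._≤_ (sym (ℤP.*-identityʳ a)) (sym (ℤP.*-identityʳ b)) a≤b)

toℚ-cancel-≤ : ∀ {a b} → toℚ a ℚ.≤ toℚ b → a ℤ.≤ b
toℚ-cancel-≤ {a} {b} p rewrite toℚ-mkℚ a | toℚ-mkℚ b with p
... | ℚ.*≤* q = subst₂ ℤ._≤_ (ℤP.*-identityʳ a) (ℤP.*-identityʳ b) q

toℚ-mono-< : ∀ {a b} → a ℤ.< b → toℚ a ℚ.< toℚ b
toℚ-mono-< {a} {b} a<b rewrite toℚ-mkℚ a | toℚ-mkℚ b =
  ℚ.*<* (subst₂ ℤ._<_ (sym (ℤP.*-identityʳ a)) (sym (ℤP.*-identityʳ b)) a<b)

Σℚ-cong : ∀ {m} {f g : Fin m → ℚ} → (∀ i → f i ≡ g i) → Σℚ f ≡ Σℚ g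
Σℚ-cong {zero} e = refl
Σℚ-cong {suc m} e = cong₂ ℚ._+_ (e fzero) (Σℚ-cong (λ i → e (fsuc i)))

toℚ-∑ℤ : ∀ m f → toℚ (∑ℤ m f) ≡ Σℚ {m} (λ i → toℚ (f (toℕ i)))
toℚ-∑ℤ zero f = refl
toℚ-∑ℤ (suc m) f = trans (toℚ-+ (f 0) _) (cong (toℚ (f 0) ℚ.+_) (toℚ-∑ℤ m (λ i → f (suc i))))

Σℚ-distrib-+ : ∀ {m} (f g : Fin m → ℚ) → Σℚ (λ i → f i ℚ.+ g i) ≡ Σℚ f ℚ.+ Σℚ g
Σℚ-distrib-+ {zero} f g = refl
Σℚ-distrib-+ {suc m} f g =
  trans (cong ((f fzero ℚ.+ g fzero) ℚ.+_) (Σℚ-distrib-+ (λ i → f (fsuc i)) (λ i → g (fsuc i))))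
        (ℚ+.interchange (f fzero) (g fzero) _ _)

Σℚ-*ˡ : ∀ {m} (k : ℚ) (f : Fin m → ℚ) → Σℚ (λ i → k ℚ.* f i) ≡ k ℚ.* Σℚ f
Σℚ-*ˡ {zero} k f = sym (ℚP.*-zeroʳ k)
Σℚ-*ˡ {suc m} k f = trans (cong ((k ℚ.* f fzero) ℚ.+_) (Σℚ-*ˡ k (λ i → f (fsuc i))))
  (sym (proj₁ ℚP.*-distrib-+ k (f fzero) _))

Σℚ-zero : ∀ {m} → Σℚ {m} (λ _ → 0ℚ) ≡ 0ℚ
Σℚ-zero {zero} = refl
Σℚ-zero {suc m} = trans (ℚP.+-identityˡ _) (Σℚ-zero {m})

Σℚ-comm : ∀ {m m′} (G : Fin m → Fin m′ → ℚ) →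
  Σℚ (λ i → Σℚ (λ j → G i j)) ≡ Σℚ (λ j → Σℚ (λ i → G i j))
Σℚ-comm {zero} {m′} G = sym (Σℚ-zero {m′})
Σℚ-comm {suc m} {m′} G =
  trans (cong (Σℚ (λ j → G fzero j) ℚ.+_) (Σℚ-comm (λ i j → G (fsuc i) j)))
        (sym (Σℚ-distrib-+ (λ j → G fzero j) _))

Σℚ-mono-≤ : ∀ {m} {f g : Fin m → ℚ} → (∀ i → f i ℚ.≤ g i) → Σℚ f ℚ.≤ Σℚ g
Σℚ-mono-≤ {zero} e = ℚP.≤-refl
Σℚ-mono-≤ {suc m} e = ℚP.+-mono-≤ (e fzero) (Σℚ-mono-≤ (λ i → e (fsuc i)))

coord : ∀ {m} → Vec ℤ m → ℕ → ℤ
coord [] l = + 0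
coord (x ∷ xs) zero = x
coord (x ∷ xs) (suc l) = coord xs l

coord-lookup : ∀ {m} (xs : Vec ℤ m) (i : Fin m) → coord xs (toℕ i) ≡ lookup xs i
coord-lookup (x ∷ xs) fzero = refl
coord-lookup (x ∷ xs) (fsuc i) = coord-lookup xs i

dim : ∀ {r} → Vec ℕ r → ℕ
dim ns = suc (total ns)

#vertices : ∀ {r} → Vec ℕ r → ℕ
#vertices {r} ns = suc (suc (total ns ℕ.+ r))

-- Coordinates are indexed from 0 here and from 1 in vertexCoord.
vertex : ∀ {r} → Vec ℕ r → ℕ → ℕ → ℤ
vertex ns j l = vertexCoord ns j (suc l)

dot : ℕ → (ℕ → ℤ) → (ℕ → ℤ) → ℤ
dot n a x = ∑ℤ n (λ l → a l ℤ.* x l)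

dot-convex-combination : ∀ {r} (ns : Vec ℕ r) (u : Point ns) (a : ℕ → ℤ) (λs : Fin (#vertices ns) → ℚ) →
  (∀ (l : Fin (dim ns)) → toℚ (lookup u l) ≡ Σℚ (λ j → λs j ℚ.* toℚ (vertex ns (toℕ j) (toℕ l)))) →
  toℚ (dot (dim ns) a (coord u)) ≡ Σℚ (λ j → λs j ℚ.* toℚ (dot (dim ns) a (vertex ns (toℕ j))))
dot-convex-combination ns u a λs u≡ = begin
  toℚ (dot N a (coord u))
    ≡⟨ toℚ-∑ℤ N (λ l → a l ℤ.* coord u l) ⟩
  Σℚ {N} (λ l → toℚ (a (toℕ l) ℤ.* coord u (toℕ l)))
    ≡⟨ Σℚ-cong {N} (λ l → trans (toℚ-* (a (toℕ l)) (coord u (toℕ l))) (cong (λ z → A l ℚ.* toℚ z) (coord-lookup u l))) ⟩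
  Σℚ {N} (λ l → A l ℚ.* toℚ (lookup u l))
    ≡⟨ Σℚ-cong {N} (λ l → trans (cong (A l ℚ.*_) (u≡ l)) (sym (Σℚ-*ˡ (A l) (λ j → λs j ℚ.* V j l)))) ⟩
  Σℚ {N} (λ l → Σℚ {M} (λ j → A l ℚ.* (λs j ℚ.* V j l)))
    ≡⟨ Σℚ-comm (λ l j → A l ℚ.* (λs j ℚ.* V j l)) ⟩
  Σℚ {M} (λ j → Σℚ {N} (λ l → A l ℚ.* (λs j ℚ.* V j l)))
    ≡⟨ Σℚ-cong {M} (λ j → trans (Σℚ-cong {N} (λ l → ℚ*.x∙yz≈y∙xz (A l) (λs j) (V j l)))
                                (Σℚ-*ˡ (λs j) (λ l → A l ℚ.* V j l))) ⟩
  Σℚ {M} (λ j → λs j ℚ.* Σℚ {N} (λ l → A l ℚ.* V j l))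
    ≡⟨ Σℚ-cong {M} (λ j → cong (λs j ℚ.*_) (sym (trans (toℚ-∑ℤ N (λ l → a l ℤ.* vertex ns (toℕ j) l))
         (Σℚ-cong {N} (λ l → toℚ-* (a (toℕ l)) (vertex ns (toℕ j) (toℕ l))))))) ⟩
  Σℚ {M} (λ j → λs j ℚ.* toℚ (dot N a (vertex ns (toℕ j)))) ∎
  where
  open ≡-Reasoning
  N = dim ns
  M = #vertices ns
  A : Fin N → ℚ
  A l = toℚ (a (toℕ l))
  V : Fin (#vertices ns) → Fin N → ℚ
  V j l = toℚ (vertex ns (toℕ j) (toℕ l))

InScaled-dot-≤ : ∀ {r} (ns : Vec ℕ r) {c : ℚ} {u : Point ns} (a : ℕ → ℤ) (d : ℤ) →
  (∀ j → j ℕ.< #vertices ns → dot (dim ns) a (vertex ns j) ℤ.≤ d) →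
  InScaled ns c u → toℚ (dot (dim ns) a (coord u)) ℚ.≤ toℚ d ℚ.* c
InScaled-dot-≤ ns {c} {u} a d a·V≤d (λs , λs≥0 , ∑λs≡c , u≡) = begin
  toℚ (dot (dim ns) a (coord u))            ≡⟨ dot-convex-combination ns u a λs u≡ ⟩
  Σℚ (λ j → λs j ℚ.* toℚ (dot (dim ns) a (vertex ns (toℕ j)))) ≤⟨ Σℚ-mono-≤ bound ⟩
  Σℚ (λ j → toℚ d ℚ.* λs j)                 ≡⟨ Σℚ-*ˡ (toℚ d) λs ⟩
  toℚ d ℚ.* Σℚ λs                           ≡⟨ cong (toℚ d ℚ.*_) ∑λs≡c ⟩
  toℚ d ℚ.* c                               ∎
  where
  open ℚP.≤-Reasoning
  bound : ∀ j → λs j ℚ.* toℚ (dot (dim ns) a (vertex ns (toℕ j))) ℚ.≤ toℚ d ℚ.* λs j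
  bound j = ℚP.≤-trans (ℚP.*-monoˡ-≤-nonNeg (λs j) {{ℚ.nonNegative (λs≥0 j)}}
                                             (toℚ-mono-≤ (a·V≤d (toℕ j) (FinP.toℕ<n j))))
                       (ℚP.≤-reflexive (ℚP.*-comm (λs j) (toℚ d)))

-- The vertices of Δ

splice : ℕ → (ℕ → ℤ) → (ℕ → ℤ) → ℕ → ℤ
splice m y z l = if l <ᵇ m then y l else z (l ∸ m)

splice-left : ∀ m y z l → l ℕ.< m → splice m y z l ≡ y l
splice-left m y z l l<m rewrite <ᵇ-true l<m = refl

splice-right : ∀ m y z l → splice m y z (m ℕ.+ l) ≡ z l
splice-right m y z l rewrite <ᵇ-false {m ℕ.+ l} {m} (ℕP.m≤m+n m l) | ℕP.m+n∸m≡n m l = refl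

∑ℤ-splice : ∀ m k (f : ℕ → ℤ → ℤ) y z →
  ∑ℤ (m ℕ.+ k) (λ l → f l (splice m y z l)) ≡ ∑ℤ m (λ l → f l (y l)) ℤ.+ ∑ℤ k (λ l → f (m ℕ.+ l) (z l))
∑ℤ-splice m k f y z = trans (∑ℤ-split m k _) (cong₂ ℤ._+_
  (∑ℤ-cong m (λ l l<m → cong (f l) (splice-left m y z l l<m)))
  (∑ℤ-cong k (λ l _ → cong (f (m ℕ.+ l)) (splice-right m y z l))))

split-at : ∀ m l → l ℕ.< m ⊎ Σ ℕ λ l′ → l ≡ m ℕ.+ l′
split-at m l with l ℕ.<? m
... | yes l<m = inj₁ l<m
... | no l≮m = inj₂ (l ∸ m , sym (ℕP.m+[n∸m]≡n (ℕP.≮⇒≥ l≮m)))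

vertex-unit : ∀ {r} (ns : Vec ℕ r) j l → 1 ℕ.≤ j → j ℕ.≤ dim ns → vertex ns j l ≡ ind (suc l ≡ᵇ j)
vertex-unit ns (suc j) l _ j≤ rewrite ≤ᵇ-true {suc j} {dim ns} j≤ = refl

vertex-corner : ∀ {r} (ns : Vec ℕ r) i l → 1 ℕ.≤ i → vertex ns (dim ns ℕ.+ i) l ≡
  ind (suc l ≡ᵇ dim ns) ℤ.- ind ((partialSum ns (i ∸ 1) <ᵇ suc l) ∧ (suc l ≤ᵇ partialSum ns i))
vertex-corner ns (suc i) l _
  rewrite ≤ᵇ-false {dim ns ℕ.+ suc i} {dim ns} (ℕP.m<m+n (dim ns) {suc i} (s≤s z≤n))
        | ℕP.m+n∸m≡n (dim ns) (suc i) = refl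

zeros minusOnes : ℕ → ℤ
zeros _ = + 0
minusOnes _ = ℤ.- + 1

-- For ns = m ∷ ns′, the vertices of Δ are those of Δ(ns′) padded by a zero first block, the unit vectors of
-- the first block, and the corner e_{n+1} − (e_1 + ⋯ + e_m).
data VertexShape {r} (m : ℕ) (ns : Vec ℕ r) (j : ℕ) : Set where
  lifted : ∀ j′ → j′ ℕ.< #vertices ns → (∀ l → vertex (m ∷ ns) j l ≡ splice m zeros (vertex ns j′) l) →
           VertexShape m ns j
  unit   : ∀ t → t ℕ.< m → (∀ l → vertex (m ∷ ns) j l ≡ kronecker l t) → VertexShape m ns j
  corner : (∀ l → vertex (m ∷ ns) j l ≡ splice m minusOnes (λ l′ → kronecker l′ (total ns)) l) →
           VertexShape m ns j

module _ {r} (m : ℕ) (ns : Vec ℕ r) where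

  private
    n = total (m ∷ ns)

  vertex-origin-lifted : ∀ l → vertex (m ∷ ns) 0 l ≡ splice m zeros (vertex ns 0) l
  vertex-origin-lifted l with l <ᵇ m
  ... | true = refl
  ... | false = refl

  vertex-unit-first : ∀ t l → t ℕ.< m → vertex (m ∷ ns) (suc t) l ≡ kronecker l t
  vertex-unit-first t l t<m
    rewrite ≤ᵇ-true {suc t} {suc n} (s≤s (ℕP.≤-trans (ℕP.<⇒≤ t<m) (ℕP.m≤m+n m (total ns)))) = refl

  vertex-unit-lifted : ∀ j′ l → 1 ℕ.≤ j′ → j′ ℕ.≤ dim ns →
    vertex (m ∷ ns) (m ℕ.+ j′) l ≡ splice m zeros (vertex ns j′) l
  vertex-unit-lifted j′ l 1≤j′ j′≤ with split-at m l
  ... | inj₁ l<m = begin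
    vertex (m ∷ ns) (m ℕ.+ j′) l ≡⟨ vertex-unit (m ∷ ns) (m ℕ.+ j′) l (ℕP.≤-trans 1≤j′ (ℕP.m≤n+m j′ m)) j+m≤ ⟩
    ind (suc l ≡ᵇ m ℕ.+ j′)     ≡⟨ cong ind (≡ᵇ-false (λ e → ℕP.<-irrefl e (ℕP.≤-<-trans l<m (ℕP.m<m+n m 1≤j′)))) ⟩
    + 0                         ≡⟨ sym (splice-left m zeros (vertex ns j′) l l<m) ⟩
    splice m zeros (vertex ns j′) l ∎
    where open ≡-Reasoning
          j+m≤ = subst (m ℕ.+ j′ ℕ.≤_) (ℕP.+-suc m (total ns)) (ℕP.+-monoʳ-≤ m j′≤)
  ... | inj₂ (l′ , refl) = begin
    vertex (m ∷ ns) (m ℕ.+ j′) (m ℕ.+ l′)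
      ≡⟨ vertex-unit (m ∷ ns) (m ℕ.+ j′) (m ℕ.+ l′) (ℕP.≤-trans 1≤j′ (ℕP.m≤n+m j′ m)) j+m≤ ⟩
    ind (suc (m ℕ.+ l′) ≡ᵇ m ℕ.+ j′)    ≡⟨ cong (λ x → ind (x ≡ᵇ m ℕ.+ j′)) (sym (ℕP.+-suc m l′)) ⟩
    ind (m ℕ.+ suc l′ ≡ᵇ m ℕ.+ j′)      ≡⟨ cong ind (+-≡ᵇ m (suc l′) j′) ⟩
    ind (suc l′ ≡ᵇ j′)                  ≡⟨ sym (vertex-unit ns j′ l′ 1≤j′ j′≤) ⟩
    vertex ns j′ l′                     ≡⟨ sym (splice-right m zeros (vertex ns j′) l′) ⟩
    splice m zeros (vertex ns j′) (m ℕ.+ l′) ∎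
    where open ≡-Reasoning
          j+m≤ = subst (m ℕ.+ j′ ℕ.≤_) (ℕP.+-suc m (total ns)) (ℕP.+-monoʳ-≤ m j′≤)

  vertex-corner-first : ∀ l → vertex (m ∷ ns) (suc n ℕ.+ 1) l ≡ splice m minusOnes (λ l′ → kronecker l′ (total ns)) l
  vertex-corner-first l with split-at m l
  ... | inj₁ l<m = begin
    vertex (m ∷ ns) (suc n ℕ.+ 1) l                      ≡⟨ vertex-corner (m ∷ ns) 1 l (s≤s z≤n) ⟩
    ind (l ≡ᵇ m ℕ.+ total ns) ℤ.- ind (suc l ≤ᵇ m ℕ.+ 0)
      ≡⟨ cong₂ (λ a b → ind a ℤ.- ind b) (≡ᵇ-false (λ e → ℕP.<-irrefl e (ℕP.<-≤-trans l<m (ℕP.m≤m+n m (total ns)))))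
                                          (≤ᵇ-true (subst (suc l ℕ.≤_) (sym (ℕP.+-identityʳ m)) l<m)) ⟩
    ℤ.- + 1                                               ≡⟨ sym (splice-left m minusOnes (λ l′ → kronecker l′ (total ns)) l l<m) ⟩
    splice m minusOnes (λ l′ → kronecker l′ (total ns)) l ∎
    where open ≡-Reasoning
  ... | inj₂ (l′ , refl) = begin
    vertex (m ∷ ns) (suc n ℕ.+ 1) (m ℕ.+ l′)              ≡⟨ vertex-corner (m ∷ ns) 1 (m ℕ.+ l′) (s≤s z≤n) ⟩
    ind (m ℕ.+ l′ ≡ᵇ m ℕ.+ total ns) ℤ.- ind (suc (m ℕ.+ l′) ≤ᵇ m ℕ.+ 0)
      ≡⟨ cong₂ (λ a b → ind a ℤ.- ind b) (+-≡ᵇ m l′ (total ns))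
               (≤ᵇ-false (s≤s (subst (ℕ._≤ m ℕ.+ l′) (sym (ℕP.+-identityʳ m)) (ℕP.m≤m+n m l′)))) ⟩
    kronecker l′ (total ns) ℤ.- + 0                        ≡⟨ ℤP.+-identityʳ _ ⟩
    kronecker l′ (total ns)                                ≡⟨ sym (splice-right m minusOnes (λ l′ → kronecker l′ (total ns)) l′) ⟩
    splice m minusOnes (λ l′ → kronecker l′ (total ns)) (m ℕ.+ l′) ∎
    where open ≡-Reasoning

  vertex-corner-lifted : ∀ i l → 1 ℕ.≤ i →
    vertex (m ∷ ns) (suc n ℕ.+ suc i) l ≡ splice m zeros (vertex ns (dim ns ℕ.+ i)) l
  vertex-corner-lifted (suc i) l _ with split-at m l
  ... | inj₁ l<m = begin
    vertex (m ∷ ns) (suc n ℕ.+ suc (suc i)) l ≡⟨ vertex-corner (m ∷ ns) (suc (suc i)) l (s≤s z≤n) ⟩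
    ind (l ≡ᵇ m ℕ.+ total ns) ℤ.- ind ((m ℕ.+ partialSum ns i <ᵇ suc l) ∧ (suc l ≤ᵇ m ℕ.+ partialSum ns (suc i)))
      ≡⟨ cong₂ (λ a b → ind a ℤ.- ind (b ∧ (suc l ≤ᵇ m ℕ.+ partialSum ns (suc i))))
               (≡ᵇ-false (λ e → ℕP.<-irrefl e (ℕP.<-≤-trans l<m (ℕP.m≤m+n m (total ns)))))
               (<ᵇ-false (ℕP.≤-trans l<m (ℕP.m≤m+n m _))) ⟩
    + 0 ≡⟨ sym (splice-left m zeros (vertex ns (dim ns ℕ.+ suc i)) l l<m) ⟩
    splice m zeros (vertex ns (dim ns ℕ.+ suc i)) l ∎
    where open ≡-Reasoning
  ... | inj₂ (l′ , refl) = begin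
    vertex (m ∷ ns) (suc n ℕ.+ suc (suc i)) (m ℕ.+ l′) ≡⟨ vertex-corner (m ∷ ns) (suc (suc i)) (m ℕ.+ l′) (s≤s z≤n) ⟩
    ind (m ℕ.+ l′ ≡ᵇ m ℕ.+ total ns) ℤ.-
      ind ((m ℕ.+ partialSum ns i <ᵇ suc (m ℕ.+ l′)) ∧ (suc (m ℕ.+ l′) ≤ᵇ m ℕ.+ partialSum ns (suc i)))
      ≡⟨ cong (λ x → ind (m ℕ.+ l′ ≡ᵇ m ℕ.+ total ns) ℤ.-
                     ind ((m ℕ.+ partialSum ns i <ᵇ x) ∧ (x ≤ᵇ m ℕ.+ partialSum ns (suc i)))) (sym (ℕP.+-suc m l′)) ⟩
    ind (m ℕ.+ l′ ≡ᵇ m ℕ.+ total ns) ℤ.-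
      ind ((m ℕ.+ partialSum ns i <ᵇ m ℕ.+ suc l′) ∧ (m ℕ.+ suc l′ ≤ᵇ m ℕ.+ partialSum ns (suc i)))
      ≡⟨ cong₂ (λ a b → ind a ℤ.- ind b) (+-≡ᵇ m l′ (total ns)) (cong₂ _∧_ (+-<ᵇ m _ _) (+-≤ᵇ m _ _)) ⟩
    ind (suc l′ ≡ᵇ dim ns) ℤ.- ind ((partialSum ns i <ᵇ suc l′) ∧ (suc l′ ≤ᵇ partialSum ns (suc i)))
      ≡⟨ sym (vertex-corner ns (suc i) l′ (s≤s z≤n)) ⟩
    vertex ns (dim ns ℕ.+ suc i) l′ ≡⟨ sym (splice-right m zeros (vertex ns (dim ns ℕ.+ suc i)) l′) ⟩
    splice m zeros (vertex ns (dim ns ℕ.+ suc i)) (m ℕ.+ l′) ∎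
    where open ≡-Reasoning

  private
    corner-shape : ∀ i j → suc n ℕ.+ i ≡ j → 1 ℕ.≤ i → j ℕ.< #vertices (m ∷ ns) → VertexShape m ns j
    corner-shape (suc zero) j refl _ _ = corner vertex-corner-first
    corner-shape (suc (suc i)) j refl _ j< =
      lifted (dim ns ℕ.+ suc i) bound (λ l → vertex-corner-lifted (suc i) l (s≤s z≤n))
      where
      i<r : suc i ℕ.≤ r
      i<r = ℕ.s≤s⁻¹ (ℕP.+-cancelˡ-≤ n _ _ (ℕ.s≤s⁻¹ (ℕ.s≤s⁻¹ j<)))
      bound : dim ns ℕ.+ suc i ℕ.< #vertices ns
      bound = s≤s (s≤s (ℕP.+-monoʳ-≤ (total ns) i<r))

  vertexShape : ∀ j → j ℕ.< #vertices (m ∷ ns) → VertexShape m ns j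
  vertexShape zero _ = lifted 0 (s≤s z≤n) vertex-origin-lifted
  vertexShape (suc t) j< with suc t ℕ.≤? m
  ... | yes t<m = unit t t<m (λ l → vertex-unit-first t l t<m)
  ... | no t≮m with suc t ℕ.≤? suc n
  ...   | yes t<n = lifted (suc t ∸ m) bound
                      (λ l → subst (λ J → vertex (m ∷ ns) J l ≡ splice m zeros (vertex ns (suc t ∸ m)) l) m+j′≡
                                   (vertex-unit-lifted (suc t ∸ m) l 1≤j′ j′≤))
    where
    m+j′≡ : m ℕ.+ (suc t ∸ m) ≡ suc t
    m+j′≡ = ℕP.m+[n∸m]≡n (ℕP.<⇒≤ (ℕP.≰⇒> t≮m))
    1≤j′ : 1 ℕ.≤ suc t ∸ m
    1≤j′ = ℕP.m<n⇒0<n∸m (ℕP.≰⇒> t≮m)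
    j′≤ : suc t ∸ m ℕ.≤ dim ns
    j′≤ = ℕP.+-cancelˡ-≤ m _ _ (subst₂ ℕ._≤_ (sym m+j′≡) (sym (ℕP.+-suc m (total ns))) t<n)
    bound : suc t ∸ m ℕ.< #vertices ns
    bound = s≤s (ℕP.≤-trans j′≤ (s≤s (ℕP.m≤m+n _ r)))
  ...   | no t≮n = corner-shape (suc t ∸ suc n) (suc t) (ℕP.m+[n∸m]≡n (ℕP.<⇒≤ (ℕP.≰⇒> t≮n)))
                                (ℕP.m<n⇒0<n∸m (ℕP.≰⇒> t≮n)) j<

  lift-vertex : ∀ j′ → j′ ℕ.< #vertices ns →
    Σ ℕ λ j → j ℕ.< #vertices (m ∷ ns) × (∀ l → vertex (m ∷ ns) j l ≡ splice m zeros (vertex ns j′) l)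
  lift-vertex zero _ = 0 , s≤s z≤n , vertex-origin-lifted
  lift-vertex (suc j′) j′< with suc j′ ℕ.≤? dim ns
  ... | yes j′≤ = m ℕ.+ suc j′ , bound , λ l → vertex-unit-lifted (suc j′) l (s≤s z≤n) j′≤
    where
    bound : m ℕ.+ suc j′ ℕ.< #vertices (m ∷ ns)
    bound = s≤s (ℕP.≤-trans (subst (m ℕ.+ suc j′ ℕ.≤_) (ℕP.+-suc m (total ns)) (ℕP.+-monoʳ-≤ m j′≤))
                            (s≤s (ℕP.m≤m+n _ (suc r))))
  ... | no j′≰ = suc n ℕ.+ suc i , bound ,
      λ l → subst (λ J → vertex (m ∷ ns) (suc n ℕ.+ suc i) l ≡ splice m zeros (vertex ns J) l) dim+i≡
                  (vertex-corner-lifted i l 1≤i)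
    where
    i = suc j′ ∸ dim ns
    dim+i≡ : dim ns ℕ.+ i ≡ suc j′
    dim+i≡ = ℕP.m+[n∸m]≡n (ℕP.<⇒≤ (ℕP.≰⇒> j′≰))
    1≤i : 1 ℕ.≤ i
    1≤i = ℕP.m<n⇒0<n∸m (ℕP.≰⇒> j′≰)
    i≤r : i ℕ.≤ r
    i≤r = ℕP.+-cancelˡ-≤ (dim ns) _ _ (subst (ℕ._≤ dim ns ℕ.+ r) (sym dim+i≡) (ℕ.s≤s⁻¹ j′<))
    bound : suc n ℕ.+ suc i ℕ.< #vertices (m ∷ ns)
    bound = s≤s (s≤s (ℕP.+-monoʳ-≤ n (s≤s i≤r)))

  unit-vertex-index : ∀ t → t ℕ.< m → suc t ℕ.< #vertices (m ∷ ns)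
  unit-vertex-index t t<m =
    s≤s (ℕP.≤-trans t<m (ℕP.≤-trans (ℕP.m≤m+n m (total ns)) (ℕP.≤-trans (ℕP.m≤m+n _ (suc r)) (ℕP.n≤1+n _))))

  corner-vertex-index : suc n ℕ.+ 1 ℕ.< #vertices (m ∷ ns)
  corner-vertex-index = s≤s (s≤s (ℕP.+-monoʳ-≤ n (s≤s (z≤n {r}))))

-- The weight as an explicit function of the point

-- max(0, max_{t<m} (−U t)): how far the block U 0, …, U (m−1) dips below zero.
deficit : ℕ → (ℕ → ℤ) → ℤ
deficit zero U = + 0
deficit (suc m) U = if ⌊ deficit m (λ l → U (suc l)) ℤ.<? ℤ.- U 0 ⌋ then ℤ.- U 0 else deficit m (λ l → U (suc l))

deficitIndex : ℕ → (ℕ → ℤ) → Maybe ℕ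
deficitIndex zero U = nothing
deficitIndex (suc m) U =
  if ⌊ deficit m (λ l → U (suc l)) ℤ.<? ℤ.- U 0 ⌋ then just 0 else Maybe.map suc (deficitIndex m (λ l → U (suc l)))

deficit-nonNeg : ∀ m U → + 0 ℤ.≤ deficit m U
deficit-nonNeg zero U = ℤP.≤-refl
deficit-nonNeg (suc m) U with deficit m (λ l → U (suc l)) ℤ.<? ℤ.- U 0
... | yes p = ℤP.≤-trans (deficit-nonNeg m _) (ℤP.<⇒≤ p)
... | no _ = deficit-nonNeg m _

deficit-≥ : ∀ m U t → t ℕ.< m → ℤ.- U t ℤ.≤ deficit m U
deficit-≥ (suc m) U zero _ with deficit m (λ l → U (suc l)) ℤ.<? ℤ.- U 0
... | yes _ = ℤP.≤-refl
... | no p = ℤP.≮⇒≥ p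
deficit-≥ (suc m) U (suc t) (s≤s t<m) with deficit m (λ l → U (suc l)) ℤ.<? ℤ.- U 0
... | yes p = ℤP.≤-trans (deficit-≥ m _ t t<m) (ℤP.<⇒≤ p)
... | no _ = deficit-≥ m _ t t<m

deficit-lub : ∀ m U v → (∀ t → t ℕ.< m → ℤ.- U t ℤ.≤ v) → + 0 ℤ.≤ v → deficit m U ℤ.≤ v
deficit-lub zero U v _ 0≤v = 0≤v
deficit-lub (suc m) U v bound 0≤v with deficit m (λ l → U (suc l)) ℤ.<? ℤ.- U 0
... | yes _ = bound 0 (s≤s z≤n)
... | no _ = deficit-lub m (λ l → U (suc l)) v (λ t t<m → bound (suc t) (s≤s t<m)) 0≤v

U+deficit-nonNeg : ∀ m U t → t ℕ.< m → + 0 ℤ.≤ U t ℤ.+ deficit m U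
U+deficit-nonNeg m U t t<m =
  ℤP.≤-trans (ℤP.≤-reflexive (sym (ℤP.+-inverseʳ (U t)))) (ℤP.+-monoʳ-≤ (U t) (deficit-≥ m U t t<m))

deficitIndex-nothing : ∀ m U → deficitIndex m U ≡ nothing → deficit m U ≡ + 0
deficitIndex-nothing zero U _ = refl
deficitIndex-nothing (suc m) U e with deficit m (λ l → U (suc l)) ℤ.<? ℤ.- U 0 | deficitIndex m (λ l → U (suc l)) in e′
... | no _ | nothing = deficitIndex-nothing m _ e′

deficitIndex-just : ∀ m U t → deficitIndex m U ≡ just t → t ℕ.< m × U t ≡ ℤ.- deficit m U
deficitIndex-just (suc m) U t e with deficit m (λ l → U (suc l)) ℤ.<? ℤ.- U 0 | deficitIndex m (λ l → U (suc l)) in e′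
deficitIndex-just (suc m) U .0 refl | yes _ | _ = s≤s z≤n , sym (ℤP.neg-involutive (U 0))
deficitIndex-just (suc m) U .(suc t) refl | no _ | just t with deficitIndex-just m _ t e′
... | t<m , Ut≡ = s≤s t<m , Ut≡

deficit-cong : ∀ m {U V : ℕ → ℤ} → (∀ l → l ℕ.< m → U l ≡ V l) → deficit m U ≡ deficit m V
deficit-cong zero e = refl
deficit-cong (suc m) {U} {V} e
  rewrite e 0 (s≤s z≤n) | deficit-cong m {λ l → U (suc l)} {λ l → V (suc l)} (λ l p → e (suc l) (s≤s p)) = refl

deficitSelector : ℕ → (ℕ → ℤ) → ℕ → ℤ
deficitSelector m U t with deficitIndex m U
... | nothing = + 0
... | just t₀ = kronecker t t₀

deficitSelector-dot : ∀ m U → ∑ℤ m (λ t → deficitSelector m U t ℤ.* U t) ≡ ℤ.- deficit m U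
deficitSelector-dot m U with deficitIndex m U in e
... | nothing = trans (∑ℤ-zero m) (cong ℤ.-_ (sym (deficitIndex-nothing m U e)))
... | just t₀ with deficitIndex-just m U t₀ e
...   | t₀<m , Ut₀≡ = trans (∑ℤ-cong m (λ t _ → ℤP.*-comm (kronecker t t₀) (U t)))
                            (trans (∑ℤ-kronecker m t₀ U t₀<m) Ut₀≡)

deficitSelector-sum : ∀ m U → ∑ℤ m (deficitSelector m U) ≡ + 0 ⊎ ∑ℤ m (deficitSelector m U) ≡ + 1
deficitSelector-sum m U with deficitIndex m U in e
... | nothing = inj₁ (∑ℤ-zero m)
... | just t₀ with deficitIndex-just m U t₀ e
...   | t₀<m , _ = inj₂ (trans (∑ℤ-cong m (λ t _ → sym (ℤP.*-identityˡ (kronecker t t₀))))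
                                (∑ℤ-kronecker m t₀ (λ _ → + 1) t₀<m))

deficitSelector-nonNeg : ∀ m U t → + 0 ℤ.≤ deficitSelector m U t
deficitSelector-nonNeg m U t with deficitIndex m U
... | nothing = ℤP.≤-refl
... | just t₀ with t ℕ.≡ᵇ t₀
...   | true = ℤ.+≤+ z≤n
...   | false = ℤP.≤-refl

blockWeight : ℕ → (ℕ → ℤ) → ℤ
blockWeight m U = ∑ℤ m U ℤ.+ (+ suc m) ℤ.* deficit m U

-- acc is the total deficit of the blocks already consumed; the last coordinate has to pay for it.
weightFormula : ∀ {r} → Vec ℕ r → ℤ → (ℕ → ℤ) → ℤ
weightFormula [] acc U = U 0 ℤ.- acc
weightFormula (m ∷ ns) acc U = blockWeight m U ℤ.+ weightFormula ns (acc ℤ.+ deficit m U) (λ l → U (m ℕ.+ l))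

Admissible : ∀ {r} → Vec ℕ r → ℤ → (ℕ → ℤ) → Set
Admissible [] acc U = acc ℤ.≤ U 0
Admissible (m ∷ ns) acc U = Admissible ns (acc ℤ.+ deficit m U) (λ l → U (m ℕ.+ l))

-- Dual certificates: linear functionals, depending on U only through the deficit selectors, whose values on
-- every vertex are ≤ 1 (resp. ≤ 0) and whose values at U are the weight (resp. the admissibility slack).
weightCertificate : ∀ {r} → Vec ℕ r → (ℕ → ℤ) → ℕ → ℤ
weightCertificate [] U l = + 1
weightCertificate (m ∷ ns) U =
  splice m (λ t → + 1 ℤ.- + m ℤ.* deficitSelector m U t) (weightCertificate ns (λ l → U (m ℕ.+ l)))

admissibilityCertificate : ∀ {r} → Vec ℕ r → (ℕ → ℤ) → ℕ → ℤ
admissibilityCertificate [] U l = ℤ.- + 1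
admissibilityCertificate (m ∷ ns) U =
  splice m (λ t → ℤ.- deficitSelector m U t) (admissibilityCertificate ns (λ l → U (m ℕ.+ l)))

private
  dim-cons : ∀ {r} m (ns : Vec ℕ r) (f : ℕ → ℤ) → ∑ℤ (dim (m ∷ ns)) f ≡ ∑ℤ (m ℕ.+ dim ns) f
  dim-cons m ns f = cong (λ N → ∑ℤ N f) (sym (ℕP.+-suc m (total ns)))

weightCertificate-dot : ∀ {r} (ns : Vec ℕ r) acc U →
  dot (dim ns) (weightCertificate ns U) U ≡ weightFormula ns acc U ℤ.+ acc
weightCertificate-dot [] acc U = trans (ℤP.+-identityʳ _) (trans (ℤP.*-identityˡ (U 0)) (split (U 0) acc))
  where
  split : ∀ u a → u ≡ (u ℤ.- a) ℤ.+ a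
  split = solve-∀
weightCertificate-dot (m ∷ ns) acc U = begin
  dot (dim (m ∷ ns)) (weightCertificate (m ∷ ns) U) U
    ≡⟨ dim-cons m ns _ ⟩
  ∑ℤ (m ℕ.+ dim ns) (λ l → weightCertificate (m ∷ ns) U l ℤ.* U l)
    ≡⟨ ∑ℤ-splice m (dim ns) (λ l x → x ℤ.* U l) (λ t → + 1 ℤ.- + m ℤ.* σ t) (weightCertificate ns U′) ⟩
  ∑ℤ m (λ t → (+ 1 ℤ.- + m ℤ.* σ t) ℤ.* U t) ℤ.+ dot (dim ns) (weightCertificate ns U′) U′
    ≡⟨ cong₂ ℤ._+_ first-block (weightCertificate-dot ns (acc ℤ.+ d) U′) ⟩
  (∑ℤ m U ℤ.+ (ℤ.- + m) ℤ.* (ℤ.- d)) ℤ.+ (weightFormula ns (acc ℤ.+ d) U′ ℤ.+ (acc ℤ.+ d))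
    ≡⟨ regroup (∑ℤ m U) (+ m) d (weightFormula ns (acc ℤ.+ d) U′) acc ⟩
  weightFormula (m ∷ ns) acc U ℤ.+ acc ∎
  where
  open ≡-Reasoning
  U′ = λ l → U (m ℕ.+ l)
  d = deficit m U
  σ = deficitSelector m U
  regroup : ∀ s x v w a → (s ℤ.+ (ℤ.- x) ℤ.* (ℤ.- v)) ℤ.+ (w ℤ.+ (a ℤ.+ v)) ≡ ((s ℤ.+ (+ 1 ℤ.+ x) ℤ.* v) ℤ.+ w) ℤ.+ a
  regroup = solve-∀
  expand : ∀ x s u → (+ 1 ℤ.- x ℤ.* s) ℤ.* u ≡ u ℤ.+ (ℤ.- x) ℤ.* (s ℤ.* u)
  expand = solve-∀
  first-block : ∑ℤ m (λ t → (+ 1 ℤ.- + m ℤ.* σ t) ℤ.* U t) ≡ ∑ℤ m U ℤ.+ (ℤ.- + m) ℤ.* (ℤ.- d)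
  first-block = begin
    ∑ℤ m (λ t → (+ 1 ℤ.- + m ℤ.* σ t) ℤ.* U t)          ≡⟨ ∑ℤ-cong m (λ t _ → expand (+ m) (σ t) (U t)) ⟩
    ∑ℤ m (λ t → U t ℤ.+ (ℤ.- + m) ℤ.* (σ t ℤ.* U t))    ≡⟨ ∑ℤ-distrib-+ m U _ ⟩
    ∑ℤ m U ℤ.+ ∑ℤ m (λ t → (ℤ.- + m) ℤ.* (σ t ℤ.* U t)) ≡⟨ cong (ℤ._+_ (∑ℤ m U)) (∑ℤ-*ˡ m (ℤ.- + m) _) ⟩
    ∑ℤ m U ℤ.+ (ℤ.- + m) ℤ.* ∑ℤ m (λ t → σ t ℤ.* U t)
      ≡⟨ cong (λ z → ∑ℤ m U ℤ.+ (ℤ.- + m) ℤ.* z) (deficitSelector-dot m U) ⟩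
    ∑ℤ m U ℤ.+ (ℤ.- + m) ℤ.* (ℤ.- d)                    ∎

admissibilityCertificate-dot : ∀ {r} (ns : Vec ℕ r) acc U →
  dot (dim ns) (admissibilityCertificate ns U) U ℤ.+ acc ℤ.≤ + 0 → Admissible ns acc U
admissibilityCertificate-dot [] acc U p =
  ℤP.≤-trans (ℤP.≤-reflexive (split (U 0) acc)) (ℤP.≤-trans (ℤP.+-monoˡ-≤ (U 0) p) (ℤP.≤-reflexive (ℤP.+-identityˡ (U 0))))
  where
  split : ∀ u a → a ≡ ((ℤ.- + 1) ℤ.* u ℤ.+ + 0) ℤ.+ a ℤ.+ u
  split = solve-∀
admissibilityCertificate-dot (m ∷ ns) acc U p =
  admissibilityCertificate-dot ns (acc ℤ.+ d) U′ (ℤP.≤-trans (ℤP.≤-reflexive rearrange) p)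
  where
  U′ = λ l → U (m ℕ.+ l)
  d = deficit m U
  rest = dot (dim ns) (admissibilityCertificate ns U′) U′
  negate : ∀ s u → ℤ.- s ℤ.* u ≡ ℤ.- (s ℤ.* u)
  negate = solve-∀
  first-block : ∑ℤ m (λ t → ℤ.- deficitSelector m U t ℤ.* U t) ≡ d
  first-block = trans (∑ℤ-cong m (λ t _ → negate (deficitSelector m U t) (U t)))
                      (trans (∑ℤ-neg m _) (trans (cong ℤ.-_ (deficitSelector-dot m U)) (ℤP.neg-involutive d)))
  regroup : ∀ s v a → s ℤ.+ (a ℤ.+ v) ≡ (v ℤ.+ s) ℤ.+ a
  regroup = solve-∀
  rearrange : rest ℤ.+ (acc ℤ.+ d) ≡ dot (dim (m ∷ ns)) (admissibilityCertificate (m ∷ ns) U) U ℤ.+ acc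
  rearrange = trans (regroup rest d acc) (cong (ℤ._+ acc) (sym (trans (dim-cons m ns _)
    (trans (∑ℤ-splice m (dim ns) (λ l x → x ℤ.* U l) (λ t → ℤ.- deficitSelector m U t) (admissibilityCertificate ns U′))
           (cong (ℤ._+ rest) first-block)))))

module _ {r} (m : ℕ) (ns : Vec ℕ r) (y a : ℕ → ℤ) where

  private
    A = splice m y a

  dot-lifted-vertex : ∀ j j′ → (∀ l → vertex (m ∷ ns) j l ≡ splice m zeros (vertex ns j′) l) →
    dot (dim (m ∷ ns)) A (vertex (m ∷ ns) j) ≡ dot (dim ns) a (vertex ns j′)
  dot-lifted-vertex j j′ Vj≡ = begin
    dot (dim (m ∷ ns)) A (vertex (m ∷ ns) j)                   ≡⟨ dim-cons m ns _ ⟩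
    ∑ℤ (m ℕ.+ dim ns) (λ l → A l ℤ.* vertex (m ∷ ns) j l)
      ≡⟨ ∑ℤ-cong (m ℕ.+ dim ns) (λ l _ → cong (A l ℤ.*_) (Vj≡ l)) ⟩
    ∑ℤ (m ℕ.+ dim ns) (λ l → A l ℤ.* splice m zeros (vertex ns j′) l)
      ≡⟨ ∑ℤ-splice m (dim ns) (λ l x → A l ℤ.* x) zeros (vertex ns j′) ⟩
    ∑ℤ m (λ l → A l ℤ.* + 0) ℤ.+ ∑ℤ (dim ns) (λ l → A (m ℕ.+ l) ℤ.* vertex ns j′ l)
      ≡⟨ cong₂ ℤ._+_ (trans (∑ℤ-cong m (λ l _ → ℤP.*-zeroʳ (A l))) (∑ℤ-zero m))
                     (∑ℤ-cong (dim ns) (λ l _ → cong (ℤ._* vertex ns j′ l) (splice-right m y a l))) ⟩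
    + 0 ℤ.+ dot (dim ns) a (vertex ns j′)                      ≡⟨ ℤP.+-identityˡ _ ⟩
    dot (dim ns) a (vertex ns j′) ∎
    where open ≡-Reasoning

  dot-unit-vertex : ∀ j t → t ℕ.< m → (∀ l → vertex (m ∷ ns) j l ≡ kronecker l t) →
    dot (dim (m ∷ ns)) A (vertex (m ∷ ns) j) ≡ y t
  dot-unit-vertex j t t<m Vj≡ =
    trans (∑ℤ-cong (dim (m ∷ ns)) (λ l _ → cong (A l ℤ.*_) (Vj≡ l)))
          (trans (∑ℤ-kronecker (dim (m ∷ ns)) t A (ℕP.≤-trans t<m (ℕP.≤-trans (ℕP.m≤m+n m (total ns)) (ℕP.n≤1+n _))))
                 (splice-left m y a t t<m))

  dot-corner-vertex : ∀ j → (∀ l → vertex (m ∷ ns) j l ≡ splice m minusOnes (λ l′ → kronecker l′ (total ns)) l) →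
    dot (dim (m ∷ ns)) A (vertex (m ∷ ns) j) ≡ ℤ.- ∑ℤ m y ℤ.+ a (total ns)
  dot-corner-vertex j Vj≡ = begin
    dot (dim (m ∷ ns)) A (vertex (m ∷ ns) j)                   ≡⟨ dim-cons m ns _ ⟩
    ∑ℤ (m ℕ.+ dim ns) (λ l → A l ℤ.* vertex (m ∷ ns) j l)
      ≡⟨ ∑ℤ-cong (m ℕ.+ dim ns) (λ l _ → cong (A l ℤ.*_) (Vj≡ l)) ⟩
    ∑ℤ (m ℕ.+ dim ns) (λ l → A l ℤ.* splice m minusOnes (λ l′ → kronecker l′ (total ns)) l)
      ≡⟨ ∑ℤ-splice m (dim ns) (λ l x → A l ℤ.* x) minusOnes (λ l′ → kronecker l′ (total ns)) ⟩
    ∑ℤ m (λ l → A l ℤ.* ℤ.- + 1) ℤ.+ ∑ℤ (dim ns) (λ l → A (m ℕ.+ l) ℤ.* kronecker l (total ns))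
      ≡⟨ cong₂ ℤ._+_ first-block
               (trans (∑ℤ-kronecker (dim ns) (total ns) (λ l → A (m ℕ.+ l)) ℕP.≤-refl) (splice-right m y a (total ns))) ⟩
    ℤ.- ∑ℤ m y ℤ.+ a (total ns) ∎
    where
    open ≡-Reasoning
    first-block : ∑ℤ m (λ l → A l ℤ.* ℤ.- + 1) ≡ ℤ.- ∑ℤ m y
    first-block = trans (∑ℤ-cong m (λ l l<m → trans (ℤP.*-comm (A l) _)
                                              (trans (ℤP.-1*i≡-i (A l)) (cong ℤ.-_ (splice-left m y a l l<m)))))
                        (∑ℤ-neg m y)

weightCertificate-last : ∀ {r} (ns : Vec ℕ r) U → weightCertificate ns U (total ns) ≡ + 1
weightCertificate-last [] U = refl
weightCertificate-last (m ∷ ns) U =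
  trans (splice-right m (λ t → + 1 ℤ.- + m ℤ.* deficitSelector m U t) (weightCertificate ns U′) (total ns))
        (weightCertificate-last ns U′)
  where U′ = λ l → U (m ℕ.+ l)

admissibilityCertificate-last : ∀ {r} (ns : Vec ℕ r) U → admissibilityCertificate ns U (total ns) ≡ ℤ.- + 1
admissibilityCertificate-last [] U = refl
admissibilityCertificate-last (m ∷ ns) U =
  trans (splice-right m (λ t → ℤ.- deficitSelector m U t) (admissibilityCertificate ns U′) (total ns))
        (admissibilityCertificate-last ns U′)
  where U′ = λ l → U (m ℕ.+ l)

module _ {r} (m : ℕ) (ns : Vec ℕ r) (U : ℕ → ℤ) where

  private
    U′ = λ l → U (m ℕ.+ l)
    σ = deficitSelector m U
    yʷ = λ t → + 1 ℤ.- + m ℤ.* σ t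
    yᵃ = λ t → ℤ.- σ t

    ∑σ≤1 : ∑ℤ m σ ℤ.≤ + 1
    ∑σ≤1 with deficitSelector-sum m U
    ... | inj₁ ∑σ≡0 = subst (ℤ._≤ + 1) (sym ∑σ≡0) (ℤ.+≤+ z≤n)
    ... | inj₂ ∑σ≡1 = ℤP.≤-reflexive ∑σ≡1

    ∑yʷ-nonNeg : + 0 ℤ.≤ ∑ℤ m yʷ
    ∑yʷ-nonNeg = subst (+ 0 ℤ.≤_) (sym ∑yʷ≡) (*-nonNeg (ℤ.+≤+ (z≤n {m})) (ℤP.i≤j⇒0≤j-i ∑σ≤1))
      where
      expand : ∀ x s → + 1 ℤ.- x ℤ.* s ≡ + 1 ℤ.+ (ℤ.- x) ℤ.* s
      expand = solve-∀
      factor : ∀ x s → x ℤ.* + 1 ℤ.+ (ℤ.- x) ℤ.* s ≡ x ℤ.* (+ 1 ℤ.- s)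
      factor = solve-∀
      ∑yʷ≡ : ∑ℤ m yʷ ≡ + m ℤ.* (+ 1 ℤ.- ∑ℤ m σ)
      ∑yʷ≡ = trans (∑ℤ-cong m (λ t _ → expand (+ m) (σ t)))
        (trans (∑ℤ-distrib-+ m (λ _ → + 1) _)
          (trans (cong₂ ℤ._+_ (∑ℤ-const m (+ 1)) (∑ℤ-*ˡ m (ℤ.- + m) σ)) (factor (+ m) (∑ℤ m σ))))

  weightCertificate-vertex-≤-cons :
    (∀ j → j ℕ.< #vertices ns → dot (dim ns) (weightCertificate ns U′) (vertex ns j) ℤ.≤ + 1) →
    ∀ j → j ℕ.< #vertices (m ∷ ns) → dot (dim (m ∷ ns)) (weightCertificate (m ∷ ns) U) (vertex (m ∷ ns) j) ℤ.≤ + 1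
  weightCertificate-vertex-≤-cons ih j j< with vertexShape m ns j j<
  ... | lifted j′ j′< Vj≡ =
    ℤP.≤-trans (ℤP.≤-reflexive (dot-lifted-vertex m ns yʷ (weightCertificate ns U′) j j′ Vj≡)) (ih j′ j′<)
  ... | unit t t<m Vj≡ = ℤP.≤-trans (ℤP.≤-reflexive (dot-unit-vertex m ns yʷ (weightCertificate ns U′) j t t<m Vj≡))
    (ℤP.+-monoʳ-≤ (+ 1) (ℤP.neg-mono-≤ (*-nonNeg (ℤ.+≤+ (z≤n {m})) (deficitSelector-nonNeg m U t))))
  ... | corner Vj≡ = ℤP.≤-trans
    (ℤP.≤-reflexive (trans (dot-corner-vertex m ns yʷ (weightCertificate ns U′) j Vj≡)
                           (cong (ℤ._+_ (ℤ.- ∑ℤ m yʷ)) (weightCertificate-last ns U′))))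
    (ℤP.+-monoˡ-≤ (+ 1) (ℤP.neg-mono-≤ ∑yʷ-nonNeg))

  admissibilityCertificate-vertex-≤-cons :
    (∀ j → j ℕ.< #vertices ns → dot (dim ns) (admissibilityCertificate ns U′) (vertex ns j) ℤ.≤ + 0) →
    ∀ j → j ℕ.< #vertices (m ∷ ns) → dot (dim (m ∷ ns)) (admissibilityCertificate (m ∷ ns) U) (vertex (m ∷ ns) j) ℤ.≤ + 0
  admissibilityCertificate-vertex-≤-cons ih j j< with vertexShape m ns j j<
  ... | lifted j′ j′< Vj≡ =
    ℤP.≤-trans (ℤP.≤-reflexive (dot-lifted-vertex m ns yᵃ (admissibilityCertificate ns U′) j j′ Vj≡)) (ih j′ j′<)
  ... | unit t t<m Vj≡ = ℤP.≤-trans (ℤP.≤-reflexive (dot-unit-vertex m ns yᵃ (admissibilityCertificate ns U′) j t t<m Vj≡))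
    (ℤP.neg-mono-≤ (deficitSelector-nonNeg m U t))
  ... | corner Vj≡ = ℤP.≤-trans
    (ℤP.≤-reflexive (trans (dot-corner-vertex m ns yᵃ (admissibilityCertificate ns U′) j Vj≡)
                           (cong (ℤ._+_ (ℤ.- ∑ℤ m yᵃ)) (admissibilityCertificate-last ns U′))))
    bound
    where
    bound : ℤ.- ∑ℤ m yᵃ ℤ.+ ℤ.- + 1 ℤ.≤ + 0
    bound = subst (λ z → z ℤ.+ ℤ.- + 1 ℤ.≤ + 0) (sym (trans (cong ℤ.-_ (∑ℤ-neg m σ)) (ℤP.neg-involutive (∑ℤ m σ))))
                  (ℤP.i≤j⇒i-j≤0 ∑σ≤1)

weightCertificate-vertex-≤ : ∀ {r} (ns : Vec ℕ r) U j → j ℕ.< #vertices ns →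
  dot (dim ns) (weightCertificate ns U) (vertex ns j) ℤ.≤ + 1
weightCertificate-vertex-≤ [] U zero _ = ℤ.+≤+ z≤n
weightCertificate-vertex-≤ [] U (suc zero) _ = ℤP.≤-refl
weightCertificate-vertex-≤ [] U (suc (suc j)) (s≤s (s≤s ()))
weightCertificate-vertex-≤ (m ∷ ns) U =
  weightCertificate-vertex-≤-cons m ns U (weightCertificate-vertex-≤ ns (λ l → U (m ℕ.+ l)))

admissibilityCertificate-vertex-≤ : ∀ {r} (ns : Vec ℕ r) U j → j ℕ.< #vertices ns →
  dot (dim ns) (admissibilityCertificate ns U) (vertex ns j) ℤ.≤ + 0
admissibilityCertificate-vertex-≤ [] U zero _ = ℤP.≤-refl
admissibilityCertificate-vertex-≤ [] U (suc zero) _ = ℤ.-≤+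
admissibilityCertificate-vertex-≤ [] U (suc (suc j)) (s≤s (s≤s ()))
admissibilityCertificate-vertex-≤ (m ∷ ns) U =
  admissibilityCertificate-vertex-≤-cons m ns U (admissibilityCertificate-vertex-≤ ns (λ l → U (m ℕ.+ l)))

listSum : {A : Set} → (A → ℤ) → List A → ℤ
listSum f [] = + 0
listSum f (x ∷ xs) = f x ℤ.+ listSum f xs

listSum-++ : {A : Set} (f : A → ℤ) (xs ys : List A) → listSum f (xs ++ ys) ≡ listSum f xs ℤ.+ listSum f ys
listSum-++ f [] ys = sym (ℤP.+-identityˡ _)
listSum-++ f (x ∷ xs) ys = trans (cong (ℤ._+_ (f x)) (listSum-++ f xs ys)) (sym (ℤP.+-assoc (f x) _ _))

listSum-map : {A B : Set} (f : B → ℤ) (g : A → B) (xs : List A) → listSum f (List.map g xs) ≡ listSum (λ x → f (g x)) xs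
listSum-map f g [] = refl
listSum-map f g (x ∷ xs) = cong (ℤ._+_ (f (g x))) (listSum-map f g xs)

listSum-cong : {A : Set} {f g : A → ℤ} (xs : List A) → (∀ x → f x ≡ g x) → listSum f xs ≡ listSum g xs
listSum-cong [] e = refl
listSum-cong (x ∷ xs) e = cong₂ ℤ._+_ (e x) (listSum-cong xs e)

listSum-zero : {A : Set} (xs : List A) → listSum (λ _ → + 0) xs ≡ + 0
listSum-zero [] = refl
listSum-zero (x ∷ xs) = trans (ℤP.+-identityˡ _) (listSum-zero xs)

listSum-nonNeg : {A : Set} (f : A → ℤ) (xs : List A) → All (λ x → + 0 ℤ.≤ f x) xs → + 0 ℤ.≤ listSum f xs
listSum-nonNeg f [] [] = ℤP.≤-refl
listSum-nonNeg f (x ∷ xs) (0≤fx ∷ 0≤fxs) = ℤP.+-mono-≤ 0≤fx (listSum-nonNeg f xs 0≤fxs)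

Below : ℕ → Set
Below M = Σ ℕ λ j → j ℕ.< M

below : ∀ m → List (Below m)
below zero = []
below (suc m) = (0 , s≤s z≤n) ∷ List.map (λ (t , t<m) → suc t , s≤s t<m) (below m)

listSum-below : ∀ m (g : ℕ → ℤ) → listSum (λ x → g (proj₁ x)) (below m) ≡ ∑ℤ m g
listSum-below zero g = refl
listSum-below (suc m) g = cong (ℤ._+_ (g 0)) (trans (listSum-map _ _ (below m)) (listSum-below m (λ t → g (suc t))))

record Decomposition {r} (ns : Vec ℕ r) (acc : ℤ) (U : ℕ → ℤ) : Set where
  field
    terms       : List (ℤ × Below (#vertices ns))
    nonNeg      : All (λ p → + 0 ℤ.≤ proj₁ p) terms
    coeff-sum   : listSum proj₁ terms ≡ weightFormula ns acc U
    combination : ∀ l → l ℕ.< dim ns →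
      listSum (λ (a , j , _) → a ℤ.* vertex ns j l) terms ≡ U l ℤ.- acc ℤ.* kronecker l (total ns)

module _ {r} (m : ℕ) (ns : Vec ℕ r) (acc : ℤ) (U : ℕ → ℤ) where

  private
    d = deficit m U
    U′ = λ l → U (m ℕ.+ l)
    V = λ l (p : ℤ × Below (#vertices (m ∷ ns))) → proj₁ p ℤ.* vertex (m ∷ ns) (proj₁ (proj₂ p)) l

  unitTerms : List (ℤ × Below (#vertices (m ∷ ns)))
  unitTerms = List.map (λ (t , t<m) → U t ℤ.+ d , suc t , unit-vertex-index m ns t t<m) (below m)

  cornerTerm : ℤ × Below (#vertices (m ∷ ns))
  cornerTerm = d , suc (total (m ∷ ns)) ℕ.+ 1 , corner-vertex-index m ns

  liftTerm : ℤ × Below (#vertices ns) → ℤ × Below (#vertices (m ∷ ns))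
  liftTerm (a , j′ , j′<) = a , proj₁ (lift-vertex m ns j′ j′<) , proj₁ (proj₂ (lift-vertex m ns j′ j′<))

  unitTerms-nonNeg : All (λ p → + 0 ℤ.≤ proj₁ p) unitTerms
  unitTerms-nonNeg = AllP.map⁺ (coefficients-nonNeg (below m))
    where
    coefficients-nonNeg : ∀ xs → All (λ (t , t<m) → + 0 ℤ.≤ U t ℤ.+ d) xs
    coefficients-nonNeg [] = []
    coefficients-nonNeg ((t , t<m) ∷ xs) = U+deficit-nonNeg m U t t<m ∷ coefficients-nonNeg xs

  unitTerms-coeff-sum : listSum proj₁ unitTerms ≡ ∑ℤ m U ℤ.+ + m ℤ.* d
  unitTerms-coeff-sum = trans (listSum-map proj₁ _ (below m))
    (trans (listSum-below m (λ t → U t ℤ.+ d))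
           (trans (∑ℤ-distrib-+ m U (λ _ → d)) (cong (ℤ._+_ (∑ℤ m U)) (∑ℤ-const m d))))

  unitTerms-combination : ∀ l → listSum (V l) unitTerms ≡ ∑ℤ m (λ t → (U t ℤ.+ d) ℤ.* kronecker l t)
  unitTerms-combination l = trans (listSum-map (V l) _ (below m))
    (trans (listSum-below m (λ t → (U t ℤ.+ d) ℤ.* vertex (m ∷ ns) (suc t) l))
           (∑ℤ-cong m (λ t t<m → cong ((U t ℤ.+ d) ℤ.*_) (vertex-unit-first m ns t l t<m))))

  liftTerm-combination : ∀ l p → V l (liftTerm p) ≡ proj₁ p ℤ.* splice m zeros (vertex ns (proj₁ (proj₂ p))) l
  liftTerm-combination l (a , j′ , j′<) = cong (a ℤ.*_) (proj₂ (proj₂ (lift-vertex m ns j′ j′<)) l)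

  decompose-cons : Decomposition ns (acc ℤ.+ d) U′ → Decomposition (m ∷ ns) acc U
  decompose-cons D = record
    { terms       = unitTerms ++ cornerTerm ∷ liftedTerms
    ; nonNeg      = AllP.++⁺ unitTerms-nonNeg (deficit-nonNeg m U ∷ AllP.map⁺ (lift-nonNeg terms′ nonNeg′))
    ; coeff-sum   = coeff-sum′
    ; combination = combination′
    }
    where
    open Decomposition D renaming (terms to terms′; nonNeg to nonNeg′; coeff-sum to ih-sum; combination to ih-comb)
    liftedTerms = List.map liftTerm terms′
    rest = cornerTerm ∷ liftedTerms

    lift-nonNeg : ∀ ps → All (λ p → + 0 ℤ.≤ proj₁ p) ps → All (λ p → + 0 ℤ.≤ proj₁ (liftTerm p)) ps
    lift-nonNeg [] [] = []
    lift-nonNeg (_ ∷ ps) (0≤a ∷ 0≤ps) = 0≤a ∷ lift-nonNeg ps 0≤ps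

    regroup : ∀ s x v w → (s ℤ.+ x ℤ.* v) ℤ.+ (v ℤ.+ w) ≡ (s ℤ.+ (+ 1 ℤ.+ x) ℤ.* v) ℤ.+ w
    regroup = solve-∀
    coeff-sum′ : listSum proj₁ (unitTerms ++ rest) ≡ weightFormula (m ∷ ns) acc U
    coeff-sum′ = begin
      listSum proj₁ (unitTerms ++ rest)             ≡⟨ listSum-++ proj₁ unitTerms rest ⟩
      listSum proj₁ unitTerms ℤ.+ (d ℤ.+ listSum proj₁ liftedTerms)
        ≡⟨ cong₂ ℤ._+_ unitTerms-coeff-sum (cong (ℤ._+_ d) (trans (listSum-map proj₁ liftTerm terms′) ih-sum)) ⟩
      (∑ℤ m U ℤ.+ + m ℤ.* d) ℤ.+ (d ℤ.+ weightFormula ns (acc ℤ.+ d) U′) ≡⟨ regroup (∑ℤ m U) (+ m) d _ ⟩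
      weightFormula (m ∷ ns) acc U ∎
      where open ≡-Reasoning

    parts : ∀ l → listSum (V l) (unitTerms ++ rest) ≡
      ∑ℤ m (λ t → (U t ℤ.+ d) ℤ.* kronecker l t) ℤ.+
      (d ℤ.* splice m minusOnes (λ l′ → kronecker l′ (total ns)) l ℤ.+
       listSum (λ (a , j′ , _) → a ℤ.* splice m zeros (vertex ns j′) l) terms′)
    parts l = trans (listSum-++ (V l) unitTerms rest) (cong₂ ℤ._+_ (unitTerms-combination l)
      (cong₂ ℤ._+_ (cong (d ℤ.*_) (vertex-corner-first m ns l))
                   (trans (listSum-map (V l) liftTerm terms′) (listSum-cong terms′ (liftTerm-combination l)))))

    in-first-block : ∀ u v a → (u ℤ.+ v) ℤ.+ (v ℤ.* ℤ.- + 1 ℤ.+ + 0) ≡ u ℤ.- a ℤ.* + 0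
    in-first-block = solve-∀
    in-rest : ∀ v i w a → + 0 ℤ.+ (v ℤ.* i ℤ.+ (w ℤ.- (a ℤ.+ v) ℤ.* i)) ≡ w ℤ.- a ℤ.* i
    in-rest = solve-∀

    combination′ : ∀ l → l ℕ.< dim (m ∷ ns) →
      listSum (V l) (unitTerms ++ rest) ≡ U l ℤ.- acc ℤ.* kronecker l (total (m ∷ ns))
    combination′ l l< with split-at m l
    ... | inj₁ l<m = begin
      listSum (V l) (unitTerms ++ rest) ≡⟨ parts l ⟩
      _ ≡⟨ cong₂ ℤ._+_ (∑ℤ-kronecker′ m l (λ t → U t ℤ.+ d) l<m)
                       (cong₂ ℤ._+_ (cong (d ℤ.*_) (splice-left m minusOnes (λ l′ → kronecker l′ (total ns)) l l<m))
                                    (trans (listSum-cong terms′ (λ (a , j′ , _) →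
                                              trans (cong (a ℤ.*_) (splice-left m zeros (vertex ns j′) l l<m)) (ℤP.*-zeroʳ a)))
                                           (listSum-zero terms′))) ⟩
      (U l ℤ.+ d) ℤ.+ (d ℤ.* ℤ.- + 1 ℤ.+ + 0) ≡⟨ in-first-block (U l) d acc ⟩
      U l ℤ.- acc ℤ.* + 0 ≡⟨ cong (λ b → U l ℤ.- acc ℤ.* ind b)
                                   (sym (≡ᵇ-false (λ e → ℕP.<-irrefl e (ℕP.<-≤-trans l<m (ℕP.m≤m+n m (total ns)))))) ⟩
      U l ℤ.- acc ℤ.* kronecker l (total (m ∷ ns)) ∎
      where open ≡-Reasoning
    ... | inj₂ (l′ , refl) = begin
      listSum (V (m ℕ.+ l′)) (unitTerms ++ rest) ≡⟨ parts (m ℕ.+ l′) ⟩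
      _ ≡⟨ cong₂ ℤ._+_ (∑ℤ-kronecker′-outside m (m ℕ.+ l′) (λ t → U t ℤ.+ d) (ℕP.m≤m+n m l′))
                       (cong₂ ℤ._+_ (cong (d ℤ.*_) (splice-right m minusOnes (λ l′ → kronecker l′ (total ns)) l′))
                                    (trans (listSum-cong terms′ (λ (a , j′ , _) →
                                              cong (a ℤ.*_) (splice-right m zeros (vertex ns j′) l′)))
                                           (ih-comb l′ l′<))) ⟩
      + 0 ℤ.+ (d ℤ.* kronecker l′ (total ns) ℤ.+ (U′ l′ ℤ.- (acc ℤ.+ d) ℤ.* kronecker l′ (total ns)))
        ≡⟨ in-rest d _ (U′ l′) acc ⟩
      U (m ℕ.+ l′) ℤ.- acc ℤ.* kronecker l′ (total ns)
        ≡⟨ cong (λ b → U (m ℕ.+ l′) ℤ.- acc ℤ.* ind b) (sym (+-≡ᵇ m l′ (total ns))) ⟩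
      U (m ℕ.+ l′) ℤ.- acc ℤ.* kronecker (m ℕ.+ l′) (total (m ∷ ns)) ∎
      where
      open ≡-Reasoning
      l′< : l′ ℕ.< dim ns
      l′< = ℕP.+-cancelˡ-< m l′ (dim ns) (subst (m ℕ.+ l′ ℕ.<_) (sym (ℕP.+-suc m (total ns))) l<)

decompose : ∀ {r} (ns : Vec ℕ r) acc U → Admissible ns acc U → Decomposition ns acc U
decompose [] acc U acc≤U₀ = record
  { terms       = (U 0 ℤ.- acc , 1 , s≤s (s≤s z≤n)) ∷ []
  ; nonNeg      = ℤP.i≤j⇒0≤j-i acc≤U₀ ∷ []
  ; coeff-sum   = ℤP.+-identityʳ _
  ; combination = λ { zero _ → single-term (U 0) acc ; (suc l) (s≤s ()) }
  }
  where
  single-term : ∀ u a → (u ℤ.- a) ℤ.* + 1 ℤ.+ + 0 ≡ u ℤ.- a ℤ.* + 1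
  single-term = solve-∀
decompose (m ∷ ns) acc U adm = decompose-cons m ns acc U (decompose ns (acc ℤ.+ deficit m U) (λ l → U (m ℕ.+ l)) adm)

weightFormula-nonNeg : ∀ {r} (ns : Vec ℕ r) acc U → Admissible ns acc U → + 0 ℤ.≤ weightFormula ns acc U
weightFormula-nonNeg ns acc U adm = subst (+ 0 ℤ.≤_) coeff-sum (listSum-nonNeg proj₁ terms nonNeg)
  where open Decomposition (decompose ns acc U adm)

ind-nonNeg : ∀ b → + 0 ℤ.≤ ind b
ind-nonNeg true = ℤ.+≤+ z≤n
ind-nonNeg false = ℤP.≤-refl

module _ {M : ℕ} where

  coefficientAt : List (ℤ × Below M) → ℕ → ℤ
  coefficientAt ps j = listSum (λ (a , j′ , _) → a ℤ.* kronecker j′ j) ps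

  coefficientAt-nonNeg : ∀ ps j → All (λ p → + 0 ℤ.≤ proj₁ p) ps → + 0 ℤ.≤ coefficientAt ps j
  coefficientAt-nonNeg [] j [] = ℤP.≤-refl
  coefficientAt-nonNeg ((a , j′ , _) ∷ ps) j (0≤a ∷ 0≤ps) =
    ℤP.+-mono-≤ (*-nonNeg 0≤a (ind-nonNeg _))
                (coefficientAt-nonNeg ps j 0≤ps)

  ∑ℤ-coefficientAt : ∀ ps (F : ℕ → ℤ) → ∑ℤ M (λ j → coefficientAt ps j ℤ.* F j) ≡ listSum (λ (a , j , _) → a ℤ.* F j) ps
  ∑ℤ-coefficientAt [] F = trans (∑ℤ-cong M (λ j _ → ℤP.*-zeroˡ (F j))) (∑ℤ-zero M)
  ∑ℤ-coefficientAt ((a , j′ , j′<) ∷ ps) F = begin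
    ∑ℤ M (λ j → (a ℤ.* kronecker j′ j ℤ.+ coefficientAt ps j) ℤ.* F j)
      ≡⟨ ∑ℤ-cong M (λ j _ → ℤP.*-distribʳ-+ (F j) (a ℤ.* kronecker j′ j) _) ⟩
    ∑ℤ M (λ j → a ℤ.* kronecker j′ j ℤ.* F j ℤ.+ coefficientAt ps j ℤ.* F j)
      ≡⟨ ∑ℤ-distrib-+ M _ _ ⟩
    ∑ℤ M (λ j → a ℤ.* kronecker j′ j ℤ.* F j) ℤ.+ ∑ℤ M (λ j → coefficientAt ps j ℤ.* F j)
      ≡⟨ cong₂ ℤ._+_ (trans (∑ℤ-cong M (λ j _ → ℤ*.xy∙z≈xz∙y a (kronecker j′ j) (F j)))
                            (∑ℤ-kronecker′ M j′ (λ j → a ℤ.* F j) j′<))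
                     (∑ℤ-coefficientAt ps F) ⟩
    a ℤ.* F j′ ℤ.+ listSum (λ (a , j , _) → a ℤ.* F j) ps ∎
    where open ≡-Reasoning

Decomposition⇒InScaled : ∀ {r} (ns : Vec ℕ r) (u : Point ns) →
  Decomposition ns (+ 0) (coord u) → InScaled ns (toℚ (weightFormula ns (+ 0) (coord u))) u
Decomposition⇒InScaled ns u D = λs , λs≥0 , ∑λs≡ , u≡
  where
  open Decomposition D
  M = #vertices ns
  λs : Fin M → ℚ
  λs j = toℚ (coefficientAt terms (toℕ j))
  λs≥0 : ∀ j → 0ℚ ℚ.≤ λs j
  λs≥0 j = toℚ-mono-≤ (coefficientAt-nonNeg terms (toℕ j) nonNeg)
  ∑λs≡ : Σℚ λs ≡ toℚ (weightFormula ns (+ 0) (coord u))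
  ∑λs≡ = trans (sym (toℚ-∑ℤ M (coefficientAt terms))) (cong toℚ (begin
    ∑ℤ M (coefficientAt terms)                               ≡⟨ ∑ℤ-cong M (λ j _ → sym (ℤP.*-identityʳ (coefficientAt terms j))) ⟩
    ∑ℤ M (λ j → coefficientAt terms j ℤ.* + 1)               ≡⟨ ∑ℤ-coefficientAt terms (λ _ → + 1) ⟩
    listSum (λ (a , _) → a ℤ.* + 1) terms                    ≡⟨ listSum-cong terms (λ (a , _) → ℤP.*-identityʳ a) ⟩
    listSum proj₁ terms                                      ≡⟨ coeff-sum ⟩
    weightFormula ns (+ 0) (coord u)                         ∎))
    where open ≡-Reasoning
  u≡ : ∀ (i : Fin (dim ns)) → toℚ (lookup u i) ≡ Σℚ (λ j → λs j ℚ.* toℚ (vertexCoord ns (toℕ j) (suc (toℕ i))))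
  u≡ i = sym (begin
    Σℚ {M} (λ j → λs j ℚ.* toℚ (vertex ns (toℕ j) l))
      ≡⟨ Σℚ-cong {M} (λ j → sym (toℚ-* (coefficientAt terms (toℕ j)) (vertex ns (toℕ j) l))) ⟩
    Σℚ {M} (λ j → toℚ (coefficientAt terms (toℕ j) ℤ.* vertex ns (toℕ j) l))
      ≡⟨ sym (toℚ-∑ℤ M (λ j → coefficientAt terms j ℤ.* vertex ns j l)) ⟩
    toℚ (∑ℤ M (λ j → coefficientAt terms j ℤ.* vertex ns j l))
      ≡⟨ cong toℚ (trans (∑ℤ-coefficientAt terms (λ j → vertex ns j l)) (combination l (FinP.toℕ<n i))) ⟩
    toℚ (coord u l ℤ.- + 0 ℤ.* kronecker l (total ns))
      ≡⟨ cong toℚ (trans (cong (ℤ._-_ (coord u l)) (ℤP.*-zeroˡ (kronecker l (total ns))))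
                         (trans (ℤP.+-identityʳ _) (coord-lookup u i))) ⟩
    toℚ (lookup u i) ∎)
    where
    open ≡-Reasoning
    l = toℕ i

InScaled⇒Admissible : ∀ {r} (ns : Vec ℕ r) {c} (u : Point ns) → InScaled ns c u → Admissible ns (+ 0) (coord u)
InScaled⇒Admissible ns {c} u u∈cΔ = admissibilityCertificate-dot ns (+ 0) U
  (subst (ℤ._≤ + 0) (sym (ℤP.+-identityʳ (dot (dim ns) (admissibilityCertificate ns U) U))) (toℚ-cancel-≤ (ℚP.≤-trans
    (InScaled-dot-≤ ns {u = u} (admissibilityCertificate ns U) (+ 0) (admissibilityCertificate-vertex-≤ ns U) u∈cΔ)
    (ℚP.≤-reflexive (ℚP.*-zeroˡ c)))))
  where U = coord u

InScaled⇒weightFormula-≤ : ∀ {r} (ns : Vec ℕ r) {c} (u : Point ns) → InScaled ns c u →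
  toℚ (weightFormula ns (+ 0) (coord u)) ℚ.≤ c
InScaled⇒weightFormula-≤ ns {c} u u∈cΔ = begin
  toℚ (weightFormula ns (+ 0) U)
    ≡⟨ cong toℚ (sym (trans (weightCertificate-dot ns (+ 0) U) (ℤP.+-identityʳ (weightFormula ns (+ 0) U)))) ⟩
  toℚ (dot (dim ns) (weightCertificate ns U) U)
    ≤⟨ InScaled-dot-≤ ns {u = u} (weightCertificate ns U) (+ 1) (weightCertificate-vertex-≤ ns U) u∈cΔ ⟩
  toℚ (+ 1) ℚ.* c
    ≡⟨ ℚP.*-identityˡ c ⟩
  c ∎
  where
  open ℚP.≤-Reasoning
  U = coord u

HasWeight⇔ : ∀ {r} (ns : Vec ℕ r) (u : Point ns) k →
  HasWeight ns u k ⇔ (Admissible ns (+ 0) (coord u) × weightFormula ns (+ 0) (coord u) ≡ + k)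
HasWeight⇔ ns u k = mk⇔ to from
  where
  U = coord u
  in-weight-dilate : Admissible ns (+ 0) U → InScaled ns (toℚ (weightFormula ns (+ 0) U)) u
  in-weight-dilate adm = Decomposition⇒InScaled ns u (decompose ns (+ 0) U adm)

  to : HasWeight ns u k → Admissible ns (+ 0) U × weightFormula ns (+ 0) U ≡ + k
  to (u∈kΔ , minimal) = adm , w≡k
    where
    adm = InScaled⇒Admissible ns u u∈kΔ
    w≡k : weightFormula ns (+ 0) U ≡ + k
    w≡k with weightFormula ns (+ 0) U ℤ.<? + k
    ... | yes w<k = ⊥-elim (minimal _ (toℚ-mono-≤ (weightFormula-nonNeg ns (+ 0) U adm)) (toℚ-mono-< w<k) (in-weight-dilate adm))
    ... | no w≮k = ℤP.≤-antisym (toℚ-cancel-≤ (InScaled⇒weightFormula-≤ ns u u∈kΔ)) (ℤP.≮⇒≥ w≮k)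

  from : Admissible ns (+ 0) U × weightFormula ns (+ 0) U ≡ + k → HasWeight ns u k
  from (adm , w≡k) = subst (λ w → InScaled ns (toℚ w) u) w≡k (in-weight-dilate adm) ,
    λ c _ c<k u∈cΔ → ℚP.<-irrefl refl
      (ℚP.≤-<-trans (subst (λ w → toℚ w ℚ.≤ c) w≡k (InScaled⇒weightFormula-≤ ns u u∈cΔ)) c<k)

∑ℕ : ℕ → (ℕ → ℕ) → ℕ
∑ℕ zero f = 0
∑ℕ (suc n) f = f 0 ℕ.+ ∑ℕ n (λ i → f (suc i))

∑ℕ-cong : ∀ n {f g : ℕ → ℕ} → (∀ i → i ℕ.< n → f i ≡ g i) → ∑ℕ n f ≡ ∑ℕ n g
∑ℕ-cong zero e = refl
∑ℕ-cong (suc n) e = cong₂ ℕ._+_ (e 0 (s≤s z≤n)) (∑ℕ-cong n (λ i p → e (suc i) (s≤s p)))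

module _ {A B : Set} (f : A → List B) where

  ∈-concatMap-witness : ∀ xs {y} → y ∈ concatMap f xs → ∃ λ x → x ∈ xs × y ∈ f x
  ∈-concatMap-witness xs = find ∘ ∈-concatMap⁻ f

  ∈-concatMap-intro : ∀ {xs x y} → x ∈ xs → y ∈ f x → y ∈ concatMap f xs
  ∈-concatMap-intro x∈xs y∈fx = ∈-concatMap⁺ f (lose x∈xs y∈fx)

  Unique-concatMap : (key : B → A) (xs : List A) → Unique xs → (∀ x → x ∈ xs → Unique (f x)) →
    (∀ x y → x ∈ xs → y ∈ f x → key y ≡ x) → Unique (concatMap f xs)
  Unique-concatMap key [] _ _ _ = []
  Unique-concatMap key (x ∷ xs) (x∉xs ∷ uxs) ufx key-ok =
    ++⁺ (ufx x (here refl)) (Unique-concatMap key xs uxs (λ x′ p → ufx x′ (there p)) (λ x′ y p → key-ok x′ y (there p)))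
        disjoint
    where
    disjoint : ∀ {y} → y ∈ f x × y ∈ concatMap f xs → ⊥
    disjoint (y∈fx , y∈rest) with ∈-concatMap-witness xs y∈rest
    ... | x′ , x′∈xs , y∈fx′ =
      All.lookup x∉xs x′∈xs (trans (sym (key-ok x _ (here refl) y∈fx)) (key-ok x′ _ (there x′∈xs) y∈fx′))

length-concatMap-applyUpTo : {B : Set} (f : ℕ → List B) (g : ℕ → ℕ) (n : ℕ) →
  length (concatMap f (List.applyUpTo g n)) ≡ ∑ℕ n (λ i → length (f (g i)))
length-concatMap-applyUpTo f g zero = refl
length-concatMap-applyUpTo f g (suc n) =
  trans (length-++ (f (g 0))) (cong (length (f (g 0)) ℕ.+_) (length-concatMap-applyUpTo f (λ i → g (suc i)) n))

length-concatMap-const : {A B : Set} (f : A → List B) (c : ℕ) (xs : List A) → (∀ x → length (f x) ≡ c) →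
  length (concatMap f xs) ≡ length xs ℕ.* c
length-concatMap-const f c [] _ = refl
length-concatMap-const f c (x ∷ xs) len≡ = trans (length-++ (f x)) (cong₂ ℕ._+_ (len≡ x) (length-concatMap-const f c xs len≡))

-- Power series over ℕ are represented by their coefficient sequences ℕ → ℕ.

∑ℕ-distrib-+ : ∀ n (f g : ℕ → ℕ) → ∑ℕ n (λ i → f i + g i) ≡ ∑ℕ n f + ∑ℕ n g
∑ℕ-distrib-+ zero f g = refl
∑ℕ-distrib-+ (suc n) f g = trans (cong ((f 0 + g 0) ℕ.+_) (∑ℕ-distrib-+ n _ _)) (ℕ+.interchange (f 0) (g 0) _ _)

∑ℕ-zero : ∀ n → ∑ℕ n (λ _ → 0) ≡ 0
∑ℕ-zero zero = refl
∑ℕ-zero (suc n) = ∑ℕ-zero n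

∑ℕ-snoc : ∀ n (f : ℕ → ℕ) → ∑ℕ (suc n) f ≡ ∑ℕ n f + f n
∑ℕ-snoc zero f = ℕP.+-comm (f 0) 0
∑ℕ-snoc (suc n) f = trans (cong (f 0 ℕ.+_) (∑ℕ-snoc n (λ i → f (suc i)))) (sym (ℕP.+-assoc (f 0) _ _))

∑ℕ-reverse : ∀ n (f : ℕ → ℕ) → ∑ℕ n f ≡ ∑ℕ n (λ i → f (n ∸ suc i))
∑ℕ-reverse zero f = refl
∑ℕ-reverse (suc n) f =
  trans (∑ℕ-snoc n f) (trans (ℕP.+-comm (∑ℕ n f) (f n)) (cong (f n ℕ.+_) (∑ℕ-reverse n f)))

∑ℕ-reverse′ : ∀ n (f : ℕ → ℕ) → ∑ℕ (suc n) (λ i → f (n ∸ i)) ≡ ∑ℕ (suc n) f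
∑ℕ-reverse′ n f = trans (∑ℕ-reverse (suc n) (λ i → f (n ∸ i)))
                        (∑ℕ-cong (suc n) (λ i i≤n → cong f (ℕP.m∸[m∸n]≡n (ℕ.s≤s⁻¹ i≤n))))

infixl 6 _⊕_
infixl 7 _⊛_

_⊕_ : (ℕ → ℕ) → (ℕ → ℕ) → ℕ → ℕ
(f ⊕ g) k = f k + g k

_⊛_ : (ℕ → ℕ) → (ℕ → ℕ) → ℕ → ℕ
(f ⊛ g) k = ∑ℕ (suc k) (λ i → f i * g (k ∸ i))

δ₀ : ℕ → ℕ
δ₀ zero = 1
δ₀ (suc k) = 0

shift : (ℕ → ℕ) → ℕ → ℕ
shift f zero = 0
shift f (suc k) = f k

partialSums : (ℕ → ℕ) → ℕ → ℕ
partialSums f k = ∑ℕ (suc k) f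

partialSums^ : ℕ → (ℕ → ℕ) → ℕ → ℕ
partialSums^ zero f = f
partialSums^ (suc m) f = partialSums (partialSums^ m f)

-- i ↦ W (k − i), read as 0 for i > k rather than as W 0.
lagged : (ℕ → ℕ) → ℕ → ℕ → ℕ
lagged W k i = if i ≤ᵇ k then W (k ∸ i) else 0

geometric : ℕ → ℕ → ℕ
geometric m k = if k <ᵇ m then 1 else 0

⊕-cong : ∀ {f f′ g g′} → f ≗ f′ → g ≗ g′ → f ⊕ g ≗ f′ ⊕ g′
⊕-cong f≗ g≗ k = cong₂ _+_ (f≗ k) (g≗ k)

⊛-cong : ∀ {f f′ g g′} → f ≗ f′ → g ≗ g′ → f ⊛ g ≗ f′ ⊛ g′
⊛-cong f≗ g≗ k = ∑ℕ-cong (suc k) (λ i _ → cong₂ _*_ (f≗ i) (g≗ (k ∸ i)))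

shift-cong : ∀ {f g} → f ≗ g → shift f ≗ shift g
shift-cong f≗ zero = refl
shift-cong f≗ (suc k) = f≗ k

partialSums-cong : ∀ {f g} → f ≗ g → partialSums f ≗ partialSums g
partialSums-cong f≗ k = ∑ℕ-cong (suc k) (λ i _ → f≗ i)

partialSums^-cong : ∀ m {f g} → f ≗ g → partialSums^ m f ≗ partialSums^ m g
partialSums^-cong zero f≗ = f≗
partialSums^-cong (suc m) f≗ = partialSums-cong (partialSums^-cong m f≗)

partialSums-suc : ∀ f k → partialSums f (suc k) ≡ partialSums f k + f (suc k)
partialSums-suc f k = ∑ℕ-snoc (suc k) f

partialSums-unique : ∀ (X f : ℕ → ℕ) → X 0 ≡ f 0 → (∀ k → X (suc k) ≡ X k + f (suc k)) → X ≗ partialSums f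
partialSums-unique X f X₀ Xₛ zero = trans X₀ (sym (ℕP.+-identityʳ (f 0)))
partialSums-unique X f X₀ Xₛ (suc k) =
  trans (Xₛ k) (trans (cong (_+ f (suc k)) (partialSums-unique X f X₀ Xₛ k)) (sym (partialSums-suc f k)))

partialSums-⊕-shift : ∀ f → partialSums f ≗ f ⊕ shift (partialSums f)
partialSums-⊕-shift f zero = refl
partialSums-⊕-shift f (suc k) = trans (partialSums-suc f k) (ℕP.+-comm (partialSums f k) (f (suc k)))

⊛-comm : ∀ f g → f ⊛ g ≗ g ⊛ f
⊛-comm f g k = trans (sym (∑ℕ-reverse′ k (λ i → f i * g (k ∸ i))))
  (∑ℕ-cong (suc k) (λ i i≤k → trans (cong (λ j → f (k ∸ i) * g j) (ℕP.m∸[m∸n]≡n (ℕ.s≤s⁻¹ i≤k)))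
                                     (ℕP.*-comm (f (k ∸ i)) (g i))))

partialSums-⊛ : ∀ f g → partialSums f ⊛ g ≗ partialSums (f ⊛ g)
partialSums-⊛ f g = partialSums-unique (partialSums f ⊛ g) (f ⊛ g) (cong (λ z → z * g 0 + 0) (ℕP.+-identityʳ (f 0))) step
  where
  step : ∀ k → (partialSums f ⊛ g) (suc k) ≡ (partialSums f ⊛ g) k + (f ⊛ g) (suc k)
  step k = begin
    partialSums f 0 * g (suc k) + ∑ℕ (suc k) (λ i → partialSums f (suc i) * g (k ∸ i))
      ≡⟨ cong₂ _+_ (cong (_* g (suc k)) (ℕP.+-identityʳ (f 0)))
           (trans (∑ℕ-cong (suc k) (λ i _ → trans (cong (_* g (k ∸ i)) (partialSums-suc f i))
                                                   (ℕP.*-distribʳ-+ (g (k ∸ i)) (partialSums f i) (f (suc i)))))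
                  (∑ℕ-distrib-+ (suc k) (λ i → partialSums f i * g (k ∸ i)) (λ i → f (suc i) * g (k ∸ i)))) ⟩
    f 0 * g (suc k) + ((partialSums f ⊛ g) k + ∑ℕ (suc k) (λ i → f (suc i) * g (k ∸ i)))
      ≡⟨ ℕ+.x∙yz≈y∙xz (f 0 * g (suc k)) ((partialSums f ⊛ g) k) _ ⟩
    (partialSums f ⊛ g) k + (f ⊛ g) (suc k) ∎
    where
    open ≡-Reasoning

⊛-partialSums : ∀ f g → f ⊛ partialSums g ≗ partialSums (f ⊛ g)
⊛-partialSums f g k = trans (⊛-comm f (partialSums g) k) (trans (partialSums-⊛ g f k) (partialSums-cong (⊛-comm g f) k))

partialSums^-⊛ : ∀ a b f g → partialSums^ a f ⊛ partialSums^ b g ≗ partialSums^ (a + b) (f ⊛ g)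
partialSums^-⊛ (suc a) b f g k = trans (partialSums-⊛ (partialSums^ a f) _ k) (partialSums-cong (partialSums^-⊛ a b f g) k)
partialSums^-⊛ zero zero f g k = refl
partialSums^-⊛ zero (suc b) f g k = trans (⊛-partialSums f (partialSums^ b g) k) (partialSums-cong (partialSums^-⊛ zero b f g) k)

partialSums^-⊕ : ∀ m f g → partialSums^ m (f ⊕ g) ≗ partialSums^ m f ⊕ partialSums^ m g
partialSums^-⊕ zero f g k = refl
partialSums^-⊕ (suc m) f g k = trans (partialSums-cong (partialSums^-⊕ m f g) k) (∑ℕ-distrib-+ (suc k) (partialSums^ m f) (partialSums^ m g))

partialSums^-shift : ∀ m f → partialSums^ m (shift f) ≗ shift (partialSums^ m f)
partialSums^-shift zero f k = refl
partialSums^-shift (suc m) f zero = partialSums-cong (partialSums^-shift m f) zero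
partialSums^-shift (suc m) f (suc k) = partialSums-cong (partialSums^-shift m f) (suc k)

δ₀-⊕-shift-geometric : ∀ m → δ₀ ⊕ shift (geometric m) ≗ geometric (suc m)
δ₀-⊕-shift-geometric m zero = refl
δ₀-⊕-shift-geometric m (suc k) = refl

-- Enumerating the points of given weight

NonNeg : ∀ m → Vec ℤ m → Set
NonNeg m x = ∀ t → t ℕ.< m → + 0 ℤ.≤ coord x t

NonNeg-∷ : ∀ {m} a (x : Vec ℤ m) → NonNeg m x → NonNeg (suc m) (+ a ∷ x)
NonNeg-∷ a x _ zero _ = ℤ.+≤+ z≤n
NonNeg-∷ a x x≥0 (suc t) (s≤s t<m) = x≥0 t t<m

NonNeg-tail : ∀ {m} h (x : Vec ℤ m) → NonNeg (suc m) (h ∷ x) → NonNeg m x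
NonNeg-tail h x hx≥0 t t<m = hx≥0 (suc t) (s≤s t<m)

HasZero : ∀ m → Vec ℤ m → Set
HasZero m x = Σ ℕ λ t → t ℕ.< m × coord x t ≡ + 0

nonNeg⇒ℕ : ∀ {z} → + 0 ℤ.≤ z → Σ ℕ λ a → z ≡ + a
nonNeg⇒ℕ {+ a} _ = a , refl

+-split : ∀ {a b s} → + a ℤ.+ + b ≡ + s → a ℕ.≤ s × b ≡ s ∸ a
+-split {a} {b} e = subst (a ℕ.≤_) a+b≡s (ℕP.m≤m+n a b) , sym (trans (cong (_∸ a) (sym a+b≡s)) (ℕP.m+n∸m≡n a b))
  where a+b≡s = ℤP.+-injective e

∣head∣ : ∀ {m} → Vec ℤ (suc m) → ℕ
∣head∣ (h ∷ _) = ℤ.∣ h ∣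

∈-map-cons : ∀ {m} a {x : Vec ℤ (suc m)} {xs} → x ∈ List.map (+ a ∷_) xs → ∣head∣ x ≡ a
∈-map-cons a x∈ with ∈-map⁻ (+ a ∷_) x∈
... | _ , _ , refl = refl

nonNegSum : (m s : ℕ) → List (Vec ℤ m)
nonNegSum zero zero = [] ∷ []
nonNegSum zero (suc s) = []
nonNegSum (suc m) s = concatMap (λ a → List.map (+ a ∷_) (nonNegSum m (s ∸ a))) (upTo (suc s))

nonNegSum-sound : ∀ m s x → x ∈ nonNegSum m s → NonNeg m x × ∑ℤ m (coord x) ≡ + s
nonNegSum-sound zero zero [] _ = (λ _ ()) , refl
nonNegSum-sound (suc m) s x x∈ with ∈-concatMap-witness _ (upTo (suc s)) x∈
... | a , a∈ , x∈′ with ∈-map⁻ (+ a ∷_) x∈′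
... | x′ , x′∈ , refl with nonNegSum-sound m (s ∸ a) x′ x′∈
... | x′≥0 , ∑x′ =
  NonNeg-∷ a x′ x′≥0 , trans (cong (ℤ._+_ (+ a)) ∑x′) (cong +_ (ℕP.m+[n∸m]≡n (ℕ.s≤s⁻¹ (∈-upTo⁻ a∈))))

nonNegSum-complete : ∀ m s x → NonNeg m x → ∑ℤ m (coord x) ≡ + s → x ∈ nonNegSum m s
nonNegSum-complete zero zero [] _ _ = here refl
nonNegSum-complete (suc m) s (h ∷ x) hx≥0 ∑≡s
  with nonNeg⇒ℕ (hx≥0 0 (s≤s z≤n)) | nonNeg⇒ℕ (∑ℤ-nonNeg m (coord x) (NonNeg-tail h x hx≥0))
... | a , refl | b , ∑x≡b with +-split {a} {b} (trans (cong (ℤ._+_ (+ a)) (sym ∑x≡b)) ∑≡s)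
... | a≤s , b≡ = ∈-concatMap-intro _ (∈-upTo⁺ (s≤s a≤s))
  (∈-map⁺ (+ a ∷_) (nonNegSum-complete m (s ∸ a) x (NonNeg-tail h x hx≥0) (trans ∑x≡b (cong +_ b≡))))

nonNegSum-unique : ∀ m s → Unique (nonNegSum m s)
nonNegSum-unique zero zero = [] ∷ []
nonNegSum-unique zero (suc s) = []
nonNegSum-unique (suc m) s = Unique-concatMap _ ∣head∣ (upTo (suc s)) (upTo⁺ (suc s))
  (λ a _ → map⁺ VecP.∷-injectiveʳ (nonNegSum-unique m (s ∸ a))) (λ a _ _ → ∈-map-cons a)

nonNegSum-len : ∀ m s → length (nonNegSum (suc m) s) ≡ ∑ℕ (suc s) (λ a → length (nonNegSum m (s ∸ a)))
nonNegSum-len m s = trans (length-concatMap-applyUpTo (λ a → List.map (+ a ∷_) (nonNegSum m (s ∸ a))) (λ i → i) (suc s))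
                          (∑ℕ-cong (suc s) (λ a _ → length-map (+ a ∷_) (nonNegSum m (s ∸ a))))

nonNegSumWithZero : (m s : ℕ) → List (Vec ℤ m)
nonNegSumWithZero zero s = []
nonNegSumWithZero (suc m) s =
  List.map (+ 0 ∷_) (nonNegSum m s) ++ concatMap (λ a → List.map (+ suc a ∷_) (nonNegSumWithZero m (s ∸ suc a))) (upTo s)

nonNegSumWithZero-sound : ∀ m s x → x ∈ nonNegSumWithZero m s → NonNeg m x × ∑ℤ m (coord x) ≡ + s × HasZero m x
nonNegSumWithZero-sound (suc m) s x x∈ with ∈-++⁻ (List.map (+ 0 ∷_) (nonNegSum m s)) x∈
... | inj₁ x∈₀ with ∈-map⁻ (+ 0 ∷_) x∈₀
...   | x′ , x′∈ , refl with nonNegSum-sound m s x′ x′∈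
...     | x′≥0 , ∑x′ = NonNeg-∷ 0 x′ x′≥0 , trans (ℤP.+-identityˡ _) ∑x′ , (0 , s≤s z≤n , refl)
nonNegSumWithZero-sound (suc m) s x x∈ | inj₂ x∈₊ with ∈-concatMap-witness _ (upTo s) x∈₊
... | a , a∈ , x∈′ with ∈-map⁻ (+ suc a ∷_) x∈′
... | x′ , x′∈ , refl with nonNegSumWithZero-sound m (s ∸ suc a) x′ x′∈
... | x′≥0 , ∑x′ , (t , t<m , x′ₜ≡0) =
  NonNeg-∷ (suc a) x′ x′≥0 ,
  trans (cong (ℤ._+_ (+ suc a)) ∑x′) (cong +_ (ℕP.m+[n∸m]≡n (∈-upTo⁻ a∈))) ,
  (suc t , s≤s t<m , x′ₜ≡0)

nonNegSumWithZero-complete : ∀ m s x → NonNeg m x → ∑ℤ m (coord x) ≡ + s → HasZero m x → x ∈ nonNegSumWithZero m s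
nonNegSumWithZero-complete (suc m) s (h ∷ x) hx≥0 ∑≡s hasZero
  with nonNeg⇒ℕ (hx≥0 0 (s≤s z≤n)) | nonNeg⇒ℕ (∑ℤ-nonNeg m (coord x) (NonNeg-tail h x hx≥0))
... | zero , refl | _ =
  ∈-++⁺ˡ (∈-map⁺ (+ 0 ∷_) (nonNegSum-complete m s x (NonNeg-tail h x hx≥0) (trans (sym (ℤP.+-identityˡ _)) ∑≡s)))
... | suc a , refl | b , ∑x≡b with +-split {suc a} {b} (trans (cong (ℤ._+_ (+ suc a)) (sym ∑x≡b)) ∑≡s) | hasZero
...   | a<s , b≡ | suc t , s≤s t<m , xₜ≡0 = ∈-++⁺ʳ (List.map (+ 0 ∷_) (nonNegSum m s)) (∈-concatMap-intro _ (∈-upTo⁺ a<s)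
  (∈-map⁺ (+ suc a ∷_) (nonNegSumWithZero-complete m (s ∸ suc a) x (NonNeg-tail h x hx≥0) (trans ∑x≡b (cong +_ b≡))
                                                  (t , t<m , xₜ≡0))))

nonNegSumWithZero-unique : ∀ m s → Unique (nonNegSumWithZero m s)
nonNegSumWithZero-unique zero s = []
nonNegSumWithZero-unique (suc m) s = ++⁺ (map⁺ VecP.∷-injectiveʳ (nonNegSum-unique m s))
  (Unique-concatMap _ (λ v → ∣head∣ v ∸ 1) (upTo s) (upTo⁺ s)
     (λ a _ → map⁺ VecP.∷-injectiveʳ (nonNegSumWithZero-unique m (s ∸ suc a)))
     (λ a _ _ x∈ → cong (_∸ 1) (∈-map-cons (suc a) x∈)))
  disjoint
  where
  disjoint : ∀ {v} → v ∈ List.map (+ 0 ∷_) (nonNegSum m s) ×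
                     v ∈ concatMap (λ a → List.map (+ suc a ∷_) (nonNegSumWithZero m (s ∸ suc a))) (upTo s) → ⊥
  disjoint (v∈₀ , v∈₊) with ∈-concatMap-witness _ (upTo s) v∈₊
  ... | a , _ , v∈ with trans (sym (∈-map-cons 0 v∈₀)) (∈-map-cons (suc a) v∈)
  ... | ()

nonNegSumWithZero-len : ∀ m s → length (nonNegSumWithZero (suc m) s) ≡
  length (nonNegSum m s) ℕ.+ ∑ℕ s (λ a → length (nonNegSumWithZero m (s ∸ suc a)))
nonNegSumWithZero-len m s = trans (length-++ (List.map (+ 0 ∷_) (nonNegSum m s)))
  (cong₂ ℕ._+_ (length-map (+ 0 ∷_) (nonNegSum m s))
    (trans (length-concatMap-applyUpTo (λ a → List.map (+ suc a ∷_) (nonNegSumWithZero m (s ∸ suc a))) (λ i → i) s)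
      (∑ℕ-cong s (λ a _ → length-map (+ suc a ∷_) (nonNegSumWithZero m (s ∸ suc a))))))

coord-map : ∀ {m} (f : ℤ → ℤ) (x : Vec ℤ m) t → t ℕ.< m → coord (Vec.map f x) t ≡ f (coord x t)
coord-map f (h ∷ x) zero _ = refl
coord-map f (h ∷ x) (suc t) (s≤s t<m) = coord-map f x t t<m

shiftDown shiftUp : ∀ {m} → ℕ → Vec ℤ m → Vec ℤ m
shiftDown c = Vec.map (ℤ._- + c)
shiftUp c = Vec.map (ℤ._+ + c)

shiftDown-shiftUp : ∀ {m} c (x : Vec ℤ m) → shiftDown c (shiftUp c x) ≡ x
shiftDown-shiftUp c [] = refl
shiftDown-shiftUp c (h ∷ x) = cong₂ _∷_ (cancel h (+ c)) (shiftDown-shiftUp c x)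
  where
  cancel : ∀ a b → (a ℤ.+ b) ℤ.- b ≡ a
  cancel = solve-∀

shiftDown-injective : ∀ {m} c {x y : Vec ℤ m} → shiftDown c x ≡ shiftDown c y → x ≡ y
shiftDown-injective c {[]} {[]} _ = refl
shiftDown-injective c {a ∷ x} {b ∷ y} e =
  cong₂ _∷_ (trans (sym (undo a)) (trans (cong (ℤ._+ + c) (VecP.∷-injectiveˡ e)) (undo b)))
            (shiftDown-injective c (VecP.∷-injectiveʳ e))
  where
  undo : ∀ a → (a ℤ.- + c) ℤ.+ + c ≡ a
  undo a = trans (ℤP.+-assoc a (ℤ.- + c) (+ c)) (trans (cong (ℤ._+_ a) (ℤP.+-inverseˡ (+ c))) (ℤP.+-identityʳ a))

deficit-NonNeg : ∀ m x → NonNeg m x → deficit m (coord x) ≡ + 0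
deficit-NonNeg m x x≥0 =
  ℤP.≤-antisym (deficit-lub m (coord x) (+ 0) (λ t t<m → ℤP.neg-mono-≤ (x≥0 t t<m)) ℤP.≤-refl) (deficit-nonNeg m (coord x))

deficit-shiftDown : ∀ m c y → NonNeg m y → HasZero m y → deficit m (coord (shiftDown c y)) ≡ + c
deficit-shiftDown m c y y≥0 (t₀ , t₀<m , yₜ₀≡0) = ℤP.≤-antisym (deficit-lub m _ (+ c) bound (ℤ.+≤+ z≤n)) attained
  where
  neg-minus : ∀ a b → ℤ.- (a ℤ.- b) ≡ (ℤ.- a) ℤ.+ b
  neg-minus = solve-∀
  bound : ∀ t → t ℕ.< m → ℤ.- coord (shiftDown c y) t ℤ.≤ + c
  bound t t<m = begin
    ℤ.- coord (shiftDown c y) t ≡⟨ trans (cong ℤ.-_ (coord-map _ y t t<m)) (neg-minus (coord y t) (+ c)) ⟩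
    ℤ.- coord y t ℤ.+ + c       ≤⟨ ℤP.+-monoˡ-≤ (+ c) (ℤP.neg-mono-≤ (y≥0 t t<m)) ⟩
    + c                         ∎
    where open ℤP.≤-Reasoning
  attained : + c ℤ.≤ deficit m (coord (shiftDown c y))
  attained = subst (ℤ._≤ deficit m (coord (shiftDown c y)))
    (trans (cong ℤ.-_ (trans (coord-map _ y t₀ t₀<m) (cong (ℤ._- + c) yₜ₀≡0))) (neg-minus (+ 0) (+ c)))
    (deficit-≥ m _ t₀ t₀<m)

blockWeight-NonNeg : ∀ m x → NonNeg m x → blockWeight m (coord x) ≡ ∑ℤ m (coord x)
blockWeight-NonNeg m x x≥0 = trans (cong (λ d → ∑ℤ m (coord x) ℤ.+ + suc m ℤ.* d) (deficit-NonNeg m x x≥0))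
  (trans (cong (ℤ._+_ (∑ℤ m (coord x))) (ℤP.*-zeroʳ (+ suc m))) (ℤP.+-identityʳ _))

blockWeight-shiftDown : ∀ m c y → NonNeg m y → HasZero m y → blockWeight m (coord (shiftDown c y)) ≡ ∑ℤ m (coord y) ℤ.+ + c
blockWeight-shiftDown m c y y≥0 hasZero = trans (cong₂ ℤ._+_ ∑≡ (cong (+ suc m ℤ.*_) (deficit-shiftDown m c y y≥0 hasZero)))
  (regroup (∑ℤ m (coord y)) (+ m) (+ c))
  where
  regroup : ∀ s m c → (s ℤ.+ ℤ.- (m ℤ.* c)) ℤ.+ (+ 1 ℤ.+ m) ℤ.* c ≡ s ℤ.+ c
  regroup = solve-∀
  ∑≡ : ∑ℤ m (coord (shiftDown c y)) ≡ ∑ℤ m (coord y) ℤ.+ ℤ.- (+ m ℤ.* + c)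
  ∑≡ = trans (∑ℤ-cong m (coord-map _ y)) (trans (∑ℤ-distrib-+ m (coord y) (λ _ → ℤ.- + c))
         (cong (ℤ._+_ (∑ℤ m (coord y))) (trans (∑ℤ-const m (ℤ.- + c)) (sym (ℤP.neg-distribʳ-* (+ m) (+ c))))))

shiftUp-NonNeg : ∀ m c x → deficit m (coord x) ≡ + c → NonNeg m (shiftUp c x)
shiftUp-NonNeg m c x d≡c t t<m = subst (+ 0 ℤ.≤_) (sym (coord-map _ x t t<m))
  (subst (λ d → + 0 ℤ.≤ coord x t ℤ.+ d) d≡c (U+deficit-nonNeg m (coord x) t t<m))

shiftUp-HasZero : ∀ m μ x → deficit m (coord x) ≡ + suc μ → HasZero m (shiftUp (suc μ) x)
shiftUp-HasZero m μ x d≡c with deficitIndex m (coord x) in e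
... | nothing with () ← trans (sym d≡c) (deficitIndex-nothing m (coord x) e)
... | just t₀ with deficitIndex-just m (coord x) t₀ e
...   | t₀<m , xₜ₀≡ = t₀ , t₀<m ,
  trans (coord-map _ x t₀ t₀<m) (trans (cong (ℤ._+ + suc μ) (trans xₜ₀≡ (cong ℤ.-_ d≡c))) (ℤP.+-inverseˡ (+ suc μ)))

blockFiber : (m j : ℕ) → List (Vec ℤ m)
blockFiber m j = nonNegSum m j ++ concatMap (λ μ → List.map (shiftDown (suc μ)) (nonNegSumWithZero m (j ∸ suc μ))) (upTo j)

blockFiber-sound : ∀ m j x → x ∈ blockFiber m j → blockWeight m (coord x) ≡ + j
blockFiber-sound m j x x∈ with ∈-++⁻ (nonNegSum m j) x∈
... | inj₁ x∈₀ = let (x≥0 , ∑≡j) = nonNegSum-sound m j x x∈₀ in trans (blockWeight-NonNeg m x x≥0) ∑≡j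
... | inj₂ x∈₊ with ∈-concatMap-witness _ (upTo j) x∈₊
... | μ , μ∈ , x∈′ with ∈-map⁻ (shiftDown (suc μ)) x∈′
... | y , y∈ , refl with nonNegSumWithZero-sound m (j ∸ suc μ) y y∈
... | y≥0 , ∑y≡ , hasZero = trans (blockWeight-shiftDown m (suc μ) y y≥0 hasZero)
  (trans (cong (ℤ._+ + suc μ) ∑y≡) (cong +_ (trans (ℕP.+-comm (j ∸ suc μ) (suc μ)) (ℕP.m+[n∸m]≡n (∈-upTo⁻ μ∈)))))

private
  module PositiveDeficit (m j μ : ℕ) (x : Vec ℤ m) (d≡c : deficit m (coord x) ≡ + suc μ) where

    y = shiftUp (suc μ) x
    y≥0 = shiftUp-NonNeg m (suc μ) x d≡c
    hasZero = shiftUp-HasZero m μ x d≡c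

    ∑y+c≡w : ∑ℤ m (coord y) ℤ.+ + suc μ ≡ blockWeight m (coord x)
    ∑y+c≡w = trans (sym (blockWeight-shiftDown m (suc μ) y y≥0 hasZero))
                   (cong (λ v → blockWeight m (coord v)) (shiftDown-shiftUp (suc μ) x))

    blockFiber-complete : blockWeight m (coord x) ≡ + j → x ∈ blockFiber m j
    blockFiber-complete w≡j with nonNeg⇒ℕ (∑ℤ-nonNeg m (coord y) y≥0)
    ... | b , ∑y≡b with +-split {suc μ} {b} (trans (ℤP.+-comm (+ suc μ) (+ b))
                                                   (trans (cong (ℤ._+ + suc μ) (sym ∑y≡b)) (trans ∑y+c≡w w≡j)))
    ... | μ<j , b≡ = ∈-++⁺ʳ (nonNegSum m j) (∈-concatMap-intro _ (∈-upTo⁺ μ<j)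
      (subst (_∈ List.map (shiftDown (suc μ)) (nonNegSumWithZero m (j ∸ suc μ))) (shiftDown-shiftUp (suc μ) x)
        (∈-map⁺ (shiftDown (suc μ)) (nonNegSumWithZero-complete m (j ∸ suc μ) y y≥0 (trans ∑y≡b (cong +_ b≡)) hasZero))))

blockFiber-complete : ∀ m j x → blockWeight m (coord x) ≡ + j → x ∈ blockFiber m j
blockFiber-complete m j x w≡j with nonNeg⇒ℕ (deficit-nonNeg m (coord x))
... | zero , d≡0 = ∈-++⁺ˡ (nonNegSum-complete m j x x≥0 (trans (sym (blockWeight-NonNeg m x x≥0)) w≡j))
  where
  x≥0 : NonNeg m x
  x≥0 t t<m = subst (+ 0 ℤ.≤_) (trans (cong (ℤ._+_ (coord x t)) d≡0) (ℤP.+-identityʳ _)) (U+deficit-nonNeg m (coord x) t t<m)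
... | suc μ , d≡c = PositiveDeficit.blockFiber-complete m j μ x d≡c w≡j

blockFiber-unique : ∀ m j → Unique (blockFiber m j)
blockFiber-unique m j = ++⁺ (nonNegSum-unique m j)
  (Unique-concatMap _ (λ v → ℤ.∣ deficit m (coord v) ∣ ∸ 1) (upTo j) (upTo⁺ j)
     (λ μ _ → map⁺ (shiftDown-injective (suc μ)) (nonNegSumWithZero-unique m (j ∸ suc μ))) deficit-key)
  disjoint
  where
  deficit-of : ∀ μ {v} → v ∈ List.map (shiftDown (suc μ)) (nonNegSumWithZero m (j ∸ suc μ)) → deficit m (coord v) ≡ + suc μ
  deficit-of μ v∈ with ∈-map⁻ (shiftDown (suc μ)) v∈
  ... | y , y∈ , refl with nonNegSumWithZero-sound m (j ∸ suc μ) y y∈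
  ... | y≥0 , _ , hasZero = deficit-shiftDown m (suc μ) y y≥0 hasZero
  deficit-key : ∀ μ v → μ ∈ upTo j → v ∈ List.map (shiftDown (suc μ)) (nonNegSumWithZero m (j ∸ suc μ)) →
    ℤ.∣ deficit m (coord v) ∣ ∸ 1 ≡ μ
  deficit-key μ v _ v∈ = cong (λ z → ℤ.∣ z ∣ ∸ 1) (deficit-of μ v∈)
  disjoint : ∀ {v} → v ∈ nonNegSum m j ×
    v ∈ concatMap (λ μ → List.map (shiftDown (suc μ)) (nonNegSumWithZero m (j ∸ suc μ))) (upTo j) → ⊥
  disjoint {v} (v∈₀ , v∈₊) with ∈-concatMap-witness _ (upTo j) v∈₊
  ... | μ , _ , v∈ with trans (sym (deficit-NonNeg m v (proj₁ (nonNegSum-sound m j v v∈₀)))) (deficit-of μ v∈)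
  ... | ()

blockFiber-len : ∀ m j → length (blockFiber m j) ≡ length (nonNegSum m j) ℕ.+ ∑ℕ j (λ μ → length (nonNegSumWithZero m (j ∸ suc μ)))
blockFiber-len m j = trans (length-++ (nonNegSum m j)) (cong (length (nonNegSum m j) ℕ.+_)
  (trans (length-concatMap-applyUpTo (λ μ → List.map (shiftDown (suc μ)) (nonNegSumWithZero m (j ∸ suc μ))) (λ i → i) j)
         (∑ℕ-cong j (λ μ _ → length-map (shiftDown (suc μ)) (nonNegSumWithZero m (j ∸ suc μ))))))

-- Of length suc (m + n) rather than m + suc n, so that Point (m ∷ ns) = Vec ℤ (suc (m + total ns)) matches
-- definitionally.
_++ᵇ_ : ∀ {m n} → Vec ℤ m → Vec ℤ (suc n) → Vec ℤ (suc (m ℕ.+ n))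
[] ++ᵇ y = y
(a ∷ x) ++ᵇ y = a ∷ (x ++ᵇ y)

takeBlock : ∀ m {n} → Vec ℤ (suc (m ℕ.+ n)) → Vec ℤ m
takeBlock zero v = []
takeBlock (suc m) (a ∷ v) = a ∷ takeBlock m v

dropBlock : ∀ m {n} → Vec ℤ (suc (m ℕ.+ n)) → Vec ℤ (suc n)
dropBlock zero v = v
dropBlock (suc m) (a ∷ v) = dropBlock m v

takeBlock-++ᵇ-dropBlock : ∀ m {n} (v : Vec ℤ (suc (m ℕ.+ n))) → takeBlock m v ++ᵇ dropBlock m v ≡ v
takeBlock-++ᵇ-dropBlock zero v = refl
takeBlock-++ᵇ-dropBlock (suc m) (a ∷ v) = cong (a ∷_) (takeBlock-++ᵇ-dropBlock m v)

takeBlock-++ᵇ : ∀ {m n} (x : Vec ℤ m) (y : Vec ℤ (suc n)) → takeBlock m (x ++ᵇ y) ≡ x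
takeBlock-++ᵇ [] y = refl
takeBlock-++ᵇ (a ∷ x) y = cong (a ∷_) (takeBlock-++ᵇ x y)

dropBlock-++ᵇ : ∀ {m n} (x : Vec ℤ m) (y : Vec ℤ (suc n)) → dropBlock m (x ++ᵇ y) ≡ y
dropBlock-++ᵇ [] y = refl
dropBlock-++ᵇ (a ∷ x) y = dropBlock-++ᵇ x y

coord-++ᵇ-left : ∀ {m n} (x : Vec ℤ m) (y : Vec ℤ (suc n)) t → t ℕ.< m → coord (x ++ᵇ y) t ≡ coord x t
coord-++ᵇ-left (a ∷ x) y zero _ = refl
coord-++ᵇ-left (a ∷ x) y (suc t) (s≤s t<m) = coord-++ᵇ-left x y t t<m

coord-++ᵇ-right : ∀ {m n} (x : Vec ℤ m) (y : Vec ℤ (suc n)) l → coord (x ++ᵇ y) (m ℕ.+ l) ≡ coord y l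
coord-++ᵇ-right [] y l = refl
coord-++ᵇ-right (a ∷ x) y l = coord-++ᵇ-right x y l

blockWeight-cong : ∀ m {U V : ℕ → ℤ} → (∀ t → t ℕ.< m → U t ≡ V t) → blockWeight m U ≡ blockWeight m V
blockWeight-cong m U≡V = cong₂ ℤ._+_ (∑ℤ-cong m U≡V) (cong (+ suc m ℤ.*_) (deficit-cong m U≡V))

blockWeight-nonNeg : ∀ m U → + 0 ℤ.≤ blockWeight m U
blockWeight-nonNeg m U = subst (+ 0 ℤ.≤_) regrouped
  (ℤP.+-mono-≤ (∑ℤ-nonNeg m _ (U+deficit-nonNeg m U)) (deficit-nonNeg m U))
  where
  d = deficit m U
  regroup : ∀ s x v → (s ℤ.+ x ℤ.* v) ℤ.+ v ≡ s ℤ.+ (+ 1 ℤ.+ x) ℤ.* v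
  regroup = solve-∀
  regrouped : ∑ℤ m (λ t → U t ℤ.+ d) ℤ.+ d ≡ blockWeight m U
  regrouped = trans (cong (ℤ._+ d) (trans (∑ℤ-distrib-+ m U (λ _ → d)) (cong (ℤ._+_ (∑ℤ m U)) (∑ℤ-const m d))))
                    (regroup (∑ℤ m U) (+ m) d)

weightFormula-cong : ∀ {r} (ns : Vec ℕ r) acc {U V : ℕ → ℤ} → U ≗ V → weightFormula ns acc U ≡ weightFormula ns acc V
weightFormula-cong [] acc U≗V = cong (ℤ._- acc) (U≗V 0)
weightFormula-cong (m ∷ ns) acc {U} U≗V = cong₂ ℤ._+_ (blockWeight-cong m (λ t _ → U≗V t))
  (trans (cong (λ d → weightFormula ns (acc ℤ.+ d) (λ l → U (m ℕ.+ l))) (deficit-cong m (λ t _ → U≗V t)))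
         (weightFormula-cong ns _ (λ l → U≗V (m ℕ.+ l))))

Admissible-cong : ∀ {r} (ns : Vec ℕ r) acc {U V : ℕ → ℤ} → U ≗ V → Admissible ns acc U → Admissible ns acc V
Admissible-cong [] acc U≗V adm = subst (acc ℤ.≤_) (U≗V 0) adm
Admissible-cong (m ∷ ns) acc {U} U≗V adm = Admissible-cong ns _ (λ l → U≗V (m ℕ.+ l))
  (subst (λ d → Admissible ns (acc ℤ.+ d) (λ l → U (m ℕ.+ l))) (deficit-cong m (λ t _ → U≗V t)) adm)

module _ {r} (m : ℕ) (ns : Vec ℕ r) (acc : ℤ) (x : Vec ℤ m) (y : Vec ℤ (dim ns)) where

  private
    deficit-++ᵇ : deficit m (coord (x ++ᵇ y)) ≡ deficit m (coord x)
    deficit-++ᵇ = deficit-cong m (coord-++ᵇ-left x y)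

  weightFormula-++ᵇ : weightFormula (m ∷ ns) acc (coord (x ++ᵇ y)) ≡
    blockWeight m (coord x) ℤ.+ weightFormula ns (acc ℤ.+ deficit m (coord x)) (coord y)
  weightFormula-++ᵇ = cong₂ ℤ._+_ (blockWeight-cong m (coord-++ᵇ-left x y))
    (trans (cong (λ d → weightFormula ns (acc ℤ.+ d) (λ l → coord (x ++ᵇ y) (m ℕ.+ l))) deficit-++ᵇ)
           (weightFormula-cong ns _ (coord-++ᵇ-right x y)))

  Admissible-++ᵇ⁺ : Admissible ns (acc ℤ.+ deficit m (coord x)) (coord y) → Admissible (m ∷ ns) acc (coord (x ++ᵇ y))
  Admissible-++ᵇ⁺ adm = subst (λ d → Admissible ns (acc ℤ.+ d) (λ l → coord (x ++ᵇ y) (m ℕ.+ l))) (sym deficit-++ᵇ)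
    (Admissible-cong ns _ (λ l → sym (coord-++ᵇ-right x y l)) adm)

  Admissible-++ᵇ⁻ : Admissible (m ∷ ns) acc (coord (x ++ᵇ y)) → Admissible ns (acc ℤ.+ deficit m (coord x)) (coord y)
  Admissible-++ᵇ⁻ adm = Admissible-cong ns _ (coord-++ᵇ-right x y)
    (subst (λ d → Admissible ns (acc ℤ.+ d) (λ l → coord (x ++ᵇ y) (m ℕ.+ l))) deficit-++ᵇ adm)

weightFiber : ∀ {r} (ns : Vec ℕ r) → ℤ → ℕ → List (Vec ℤ (dim ns))
weightFiber [] acc k = ((acc ℤ.+ + k) ∷ []) ∷ []
weightFiber (m ∷ ns) acc k =
  concatMap (λ j → concatMap (λ x → List.map (x ++ᵇ_) (weightFiber ns (acc ℤ.+ deficit m (coord x)) (k ∸ j))) (blockFiber m j))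
            (upTo (suc k))

weightFiber-sound : ∀ {r} (ns : Vec ℕ r) acc k u → u ∈ weightFiber ns acc k →
  Admissible ns acc (coord u) × weightFormula ns acc (coord u) ≡ + k
weightFiber-sound [] acc k u (here refl) = ℤP.i≤i+j acc (+ k) , cancel acc (+ k)
  where
  cancel : ∀ a k → (a ℤ.+ k) ℤ.- a ≡ k
  cancel = solve-∀
weightFiber-sound (m ∷ ns) acc k u u∈ with ∈-concatMap-witness _ (upTo (suc k)) u∈
... | j , j∈ , u∈′ with ∈-concatMap-witness _ (blockFiber m j) u∈′
... | x , x∈ , u∈″ with ∈-map⁻ (x ++ᵇ_) u∈″
... | y , y∈ , refl with weightFiber-sound ns (acc ℤ.+ deficit m (coord x)) (k ∸ j) y y∈
... | adm , w≡ = Admissible-++ᵇ⁺ m ns acc x y adm ,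
  trans (weightFormula-++ᵇ m ns acc x y)
        (trans (cong₂ ℤ._+_ (blockFiber-sound m j x x∈) w≡) (cong +_ (ℕP.m+[n∸m]≡n (ℕ.s≤s⁻¹ (∈-upTo⁻ j∈)))))

weightFiber-complete : ∀ {r} (ns : Vec ℕ r) acc k u → Admissible ns acc (coord u) → weightFormula ns acc (coord u) ≡ + k →
  u ∈ weightFiber ns acc k
weightFiber-complete [] acc k (v ∷ []) _ w≡k = here (cong (_∷ []) (trans (sym (cancel v acc)) (cong (ℤ._+_ acc) w≡k)))
  where
  cancel : ∀ v a → a ℤ.+ (v ℤ.- a) ≡ v
  cancel = solve-∀
weightFiber-complete (m ∷ ns) acc k u adm w≡k = subst (_∈ weightFiber (m ∷ ns) acc k) x++y≡u
  (complete-++ᵇ x y (Admissible-++ᵇ⁻ m ns acc x y (subst (λ v → Admissible (m ∷ ns) acc (coord v)) (sym x++y≡u) adm))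
                    (trans (sym (weightFormula-++ᵇ m ns acc x y))
                           (trans (cong (λ v → weightFormula (m ∷ ns) acc (coord v)) x++y≡u) w≡k)))
  where
  x = takeBlock m u
  y = dropBlock m u
  x++y≡u = takeBlock-++ᵇ-dropBlock m u
  complete-++ᵇ : ∀ x y → Admissible ns (acc ℤ.+ deficit m (coord x)) (coord y) →
    blockWeight m (coord x) ℤ.+ weightFormula ns (acc ℤ.+ deficit m (coord x)) (coord y) ≡ + k →
    x ++ᵇ y ∈ weightFiber (m ∷ ns) acc k
  complete-++ᵇ x y adm′ ∑≡k with nonNeg⇒ℕ (blockWeight-nonNeg m (coord x)) | nonNeg⇒ℕ (weightFormula-nonNeg ns _ (coord y) adm′)
  ... | j , bw≡j | w , w≡w with +-split {j} {w} (trans (cong₂ ℤ._+_ (sym bw≡j) (sym w≡w)) ∑≡k)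
  ... | j≤k , w≡ = ∈-concatMap-intro _ (∈-upTo⁺ (s≤s j≤k)) (∈-concatMap-intro _ (blockFiber-complete m j x bw≡j)
    (∈-map⁺ (x ++ᵇ_) (weightFiber-complete ns _ (k ∸ j) y adm′ (trans w≡w (cong +_ w≡)))))

weightFiber-unique : ∀ {r} (ns : Vec ℕ r) acc k → Unique (weightFiber ns acc k)
weightFiber-unique [] acc k = [] ∷ []
weightFiber-unique (m ∷ ns) acc k =
  Unique-concatMap _ (λ v → ℤ.∣ blockWeight m (coord (takeBlock m v)) ∣) (upTo (suc k)) (upTo⁺ (suc k)) unique-j key-j
  where
  extensions : ℕ → Vec ℤ m → List (Vec ℤ (dim (m ∷ ns)))
  extensions j x = List.map (x ++ᵇ_) (weightFiber ns (acc ℤ.+ deficit m (coord x)) (k ∸ j))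
  unique-j : ∀ j → j ∈ upTo (suc k) → Unique (concatMap (extensions j) (blockFiber m j))
  unique-j j _ = Unique-concatMap _ (takeBlock m) (blockFiber m j) (blockFiber-unique m j)
    (λ x _ → map⁺ (λ {y} {y′} e → trans (sym (dropBlock-++ᵇ x y)) (trans (cong (dropBlock m) e) (dropBlock-++ᵇ x y′)))
                  (weightFiber-unique ns _ (k ∸ j)))
    (λ x v _ v∈ → let (y , _ , v≡) = ∈-map⁻ (x ++ᵇ_) v∈ in trans (cong (takeBlock m) v≡) (takeBlock-++ᵇ x y))
  key-j : ∀ j v → j ∈ upTo (suc k) → v ∈ concatMap (extensions j) (blockFiber m j) →
    ℤ.∣ blockWeight m (coord (takeBlock m v)) ∣ ≡ j
  key-j j v _ v∈ with ∈-concatMap-witness _ (blockFiber m j) v∈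
  ... | x , x∈ , v∈′ with ∈-map⁻ (x ++ᵇ_) v∈′
  ... | y , _ , refl = cong ℤ.∣_∣ (trans (cong (λ z → blockWeight m (coord z)) (takeBlock-++ᵇ x y)) (blockFiber-sound m j x x∈))

weightCount : ∀ {r} → Vec ℕ r → ℕ → ℕ
weightCount [] k = 1
weightCount (m ∷ ns) = (λ j → length (blockFiber m j)) ⊛ weightCount ns

weightFiber-length : ∀ {r} (ns : Vec ℕ r) acc k → length (weightFiber ns acc k) ≡ weightCount ns k
weightFiber-length [] acc k = refl
weightFiber-length (m ∷ ns) acc k = trans (length-concatMap-applyUpTo (λ j → concatMap (extensions j) (blockFiber m j)) (λ i → i) (suc k))
  (∑ℕ-cong (suc k) (λ j _ → length-concatMap-const (extensions j) (weightCount ns (k ∸ j)) (blockFiber m j)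
    (λ x → trans (length-map (x ++ᵇ_) (weightFiber ns (acc ℤ.+ deficit m (coord x)) (k ∸ j)))
                 (weightFiber-length ns (acc ℤ.+ deficit m (coord x)) (k ∸ j)))))
  where
  extensions : ℕ → Vec ℤ m → List (Vec ℤ (dim (m ∷ ns)))
  extensions j x = List.map (x ++ᵇ_) (weightFiber ns (acc ℤ.+ deficit m (coord x)) (k ∸ j))

private
  ∑ℕ-reverse-shift : ∀ f s → ∑ℕ s (λ a → f (s ∸ suc a)) ≡ shift (partialSums f) s
  ∑ℕ-reverse-shift f zero = refl
  ∑ℕ-reverse-shift f (suc s) = ∑ℕ-reverse′ s f

-- Generating functions and Hodge numbers

#nonNegSum #nonNegSumWithZero #blockFiber : ℕ → ℕ → ℕ
#nonNegSum m s = length (nonNegSum m s)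
#nonNegSumWithZero m s = length (nonNegSumWithZero m s)
#blockFiber m j = length (blockFiber m j)

#nonNegSum≗ : ∀ m → #nonNegSum m ≗ partialSums^ m δ₀
#nonNegSum≗ zero zero = refl
#nonNegSum≗ zero (suc s) = refl
#nonNegSum≗ (suc m) s =
  trans (nonNegSum-len m s) (trans (∑ℕ-reverse′ s (#nonNegSum m)) (partialSums-cong (#nonNegSum≗ m) s))

#nonNegSumWithZero-suc : ∀ m → #nonNegSumWithZero (suc m) ≗ #nonNegSum m ⊕ shift (partialSums (#nonNegSumWithZero m))
#nonNegSumWithZero-suc m s = trans (nonNegSumWithZero-len m s) (cong (#nonNegSum m s ℕ.+_) (∑ℕ-reverse-shift (#nonNegSumWithZero m) s))

#blockFiber-split : ∀ m → #blockFiber m ≗ #nonNegSum m ⊕ shift (partialSums (#nonNegSumWithZero m))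
#blockFiber-split m s = trans (blockFiber-len m s) (cong (#nonNegSum m s ℕ.+_) (∑ℕ-reverse-shift (#nonNegSumWithZero m) s))

private
  blockFiberSplit≗ : ∀ m → #nonNegSum m ⊕ shift (partialSums (#nonNegSumWithZero m)) ≗ partialSums^ m (geometric (suc m))
  blockFiberSplit≗ zero zero = refl
  blockFiberSplit≗ zero (suc k) = ∑ℕ-zero (suc k)
  blockFiberSplit≗ (suc m) k = begin
    #nonNegSum (suc m) k + shift (partialSums (#nonNegSumWithZero (suc m))) k
      ≡⟨ ⊕-cong (#nonNegSum≗ (suc m))
                (shift-cong (partialSums-cong (λ s → trans (#nonNegSumWithZero-suc m s) (blockFiberSplit≗ m s)))) k ⟩
    partialSums^ (suc m) δ₀ k + shift (partialSums^ (suc m) (geometric (suc m))) k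
      ≡⟨ cong (partialSums^ (suc m) δ₀ k ℕ.+_) (sym (partialSums^-shift (suc m) (geometric (suc m)) k)) ⟩
    partialSums^ (suc m) δ₀ k + partialSums^ (suc m) (shift (geometric (suc m))) k
      ≡⟨ sym (partialSums^-⊕ (suc m) δ₀ (shift (geometric (suc m))) k) ⟩
    partialSums^ (suc m) (δ₀ ⊕ shift (geometric (suc m))) k
      ≡⟨ partialSums^-cong (suc m) (δ₀-⊕-shift-geometric (suc m)) k ⟩
    partialSums^ (suc m) (geometric (suc (suc m))) k ∎
    where open ≡-Reasoning

#blockFiber≗ : ∀ m → #blockFiber m ≗ partialSums^ m (geometric (suc m))
#blockFiber≗ m k = trans (#blockFiber-split m k) (blockFiberSplit≗ m k)

G₁-series : ∀ {r} → Vec ℕ r → ℕ → ℕ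
G₁-series [] = δ₀
G₁-series (m ∷ ns) = geometric (suc m) ⊛ G₁-series ns

weightCount≗ : ∀ {r} (ns : Vec ℕ r) → weightCount ns ≗ partialSums^ (suc (total ns)) (G₁-series ns)
weightCount≗ [] k = sym (cong suc (∑ℕ-zero k))
weightCount≗ (m ∷ ns) k = begin
  weightCount (m ∷ ns) k
    ≡⟨ ⊛-cong (#blockFiber≗ m) (weightCount≗ ns) k ⟩
  (partialSums^ m (geometric (suc m)) ⊛ partialSums^ (suc (total ns)) (G₁-series ns)) k
    ≡⟨ partialSums^-⊛ m (suc (total ns)) (geometric (suc m)) (G₁-series ns) k ⟩
  partialSums^ (m + suc (total ns)) (G₁-series (m ∷ ns)) k
    ≡⟨ cong (λ N → partialSums^ N (G₁-series (m ∷ ns)) k) (ℕP.+-suc m (total ns)) ⟩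
  partialSums^ (suc (total (m ∷ ns))) (G₁-series (m ∷ ns)) k ∎
  where open ≡-Reasoning

altSign : ℕ → ℤ
altSign i = if (i % 2) ≡ᵇ 0 then + 1 else ℤ.- (+ 1)

-- ∇ᵐ W, the coefficients of (1 − x)ᵐ W(x).
∇^ : ℕ → (ℕ → ℕ) → ℕ → ℤ
∇^ m W k = ∑ℤ (suc m) (λ i → altSign i ℤ.* + ((m C i) ℕ.* lagged W k i))

Hodge≡∇^ : ∀ n W k → Hodge n W k ≡ ∇^ (suc n) W k
Hodge≡∇^ n W k = foldr-map-applyUpTo (λ i → altSign i ℤ.* + ((suc n C i) ℕ.* lagged W k i)) (λ i → i) (suc (suc n))
  where
  foldr-map-applyUpTo : ∀ (f : ℕ → ℤ) (g : ℕ → ℕ) N →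
    List.foldr ℤ._+_ (+ 0) (List.map f (applyUpTo g N)) ≡ ∑ℤ N (λ i → f (g i))
  foldr-map-applyUpTo f g zero = refl
  foldr-map-applyUpTo f g (suc N) = cong (ℤ._+_ (f (g 0))) (foldr-map-applyUpTo f (λ i → g (suc i)) N)

altSign-suc : ∀ i → altSign (suc i) ≡ ℤ.- altSign i
altSign-suc zero = refl
altSign-suc (suc i) = sym (trans (cong ℤ.-_ (altSign-suc i)) (ℤP.neg-involutive (altSign i)))

lagged-suc : ∀ W k i → lagged W k (suc i) ≡ lagged (shift W) k i
lagged-suc W k i with ℕP.<-cmp i k
... | tri< i<k _ _ rewrite ≤ᵇ-true {suc i} {k} i<k | ≤ᵇ-true {i} {k} (ℕP.<⇒≤ i<k) | ℕP.+-∸-assoc 1 i<k = refl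
... | tri≈ _ refl _ rewrite ≤ᵇ-false {suc i} {i} ℕP.≤-refl | ≤ᵇ-true {i} {i} ℕP.≤-refl | ℕP.n∸n≡0 i = refl
... | tri> _ _ k<i rewrite ≤ᵇ-false {suc i} {k} (ℕP.<-trans k<i (ℕP.n<1+n i)) | ≤ᵇ-false {i} {k} k<i = refl

module _ (m : ℕ) (W : ℕ → ℕ) (k : ℕ) where

  private
    term : ℕ → (ℕ → ℕ) → ℕ → ℤ
    term m′ V i = altSign i ℤ.* + ((m′ C i) ℕ.* lagged V k i)

  pascal-term : ∀ i → term (suc m) W (suc i) ≡ ℤ.- term m (shift W) i ℤ.+ term m W (suc i)
  pascal-term i = begin
    altSign (suc i) ℤ.* + ((suc m C suc i) ℕ.* A (suc i))
      ≡⟨ cong₂ (λ s c → s ℤ.* + (c ℕ.* A (suc i))) (altSign-suc i) (sym (nCk+nC[k+1]≡[n+1]C[k+1] m i)) ⟩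
    (ℤ.- altSign i) ℤ.* + (((m C i) ℕ.+ (m C suc i)) ℕ.* A (suc i))
      ≡⟨ cong (λ z → (ℤ.- altSign i) ℤ.* + z) (ℕP.*-distribʳ-+ (A (suc i)) (m C i) (m C suc i)) ⟩
    (ℤ.- altSign i) ℤ.* (+ ((m C i) ℕ.* A (suc i)) ℤ.+ + ((m C suc i) ℕ.* A (suc i)))
      ≡⟨ distrib (altSign i) _ _ ⟩
    ℤ.- (altSign i ℤ.* + ((m C i) ℕ.* A (suc i))) ℤ.+ (ℤ.- altSign i) ℤ.* + ((m C suc i) ℕ.* A (suc i))
      ≡⟨ cong₂ (λ a s → ℤ.- (altSign i ℤ.* + ((m C i) ℕ.* a)) ℤ.+ s ℤ.* + ((m C suc i) ℕ.* A (suc i)))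
               (lagged-suc W k i) (sym (altSign-suc i)) ⟩
    ℤ.- term m (shift W) i ℤ.+ term m W (suc i) ∎
    where
    open ≡-Reasoning
    A = lagged W k
    distrib : ∀ s x y → (ℤ.- s) ℤ.* (x ℤ.+ y) ≡ ℤ.- (s ℤ.* x) ℤ.+ (ℤ.- s) ℤ.* y
    distrib = solve-∀

  ∇^-suc : ∇^ (suc m) W k ≡ ∇^ m W k ℤ.- ∇^ m (shift W) k
  ∇^-suc = begin
    term (suc m) W 0 ℤ.+ ∑ℤ (suc m) (λ i → term (suc m) W (suc i))
      ≡⟨ cong (ℤ._+_ (term (suc m) W 0)) (trans (∑ℤ-cong (suc m) (λ i _ → pascal-term i))
                                                (∑ℤ-distrib-+ (suc m) (λ i → ℤ.- term m (shift W) i) (λ i → term m W (suc i)))) ⟩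
    term m W 0 ℤ.+ (∑ℤ (suc m) (λ i → ℤ.- term m (shift W) i) ℤ.+ ∑ℤ (suc m) (λ i → term m W (suc i)))
      ≡⟨ cong (λ z → term m W 0 ℤ.+ (z ℤ.+ ∑ℤ (suc m) (λ i → term m W (suc i)))) (∑ℤ-neg (suc m) (term m (shift W))) ⟩
    term m W 0 ℤ.+ (ℤ.- ∇^ m (shift W) k ℤ.+ ∑ℤ (suc m) (λ i → term m W (suc i)))
      ≡⟨ regroup (term m W 0) (∇^ m (shift W) k) _ ⟩
    ∑ℤ (suc (suc m)) (term m W) ℤ.- ∇^ m (shift W) k
      ≡⟨ cong (ℤ._- ∇^ m (shift W) k) (trans (∑ℤ-snoc (suc m) (term m W))
                                             (trans (cong (ℤ._+_ (∇^ m W k)) last-term) (ℤP.+-identityʳ (∇^ m W k)))) ⟩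
    ∇^ m W k ℤ.- ∇^ m (shift W) k ∎
    where
    open ≡-Reasoning
    regroup : ∀ a h s → a ℤ.+ (ℤ.- h ℤ.+ s) ≡ (a ℤ.+ s) ℤ.- h
    regroup = solve-∀
    last-term : term m W (suc m) ≡ + 0
    last-term = trans (cong (λ c → altSign (suc m) ℤ.* + (c ℕ.* lagged W k (suc m))) (k>n⇒nCk≡0 (ℕP.n<1+n m)))
                      (ℤP.*-zeroʳ (altSign (suc m)))

∇^-cong : ∀ m {W W′ : ℕ → ℕ} k → W ≗ W′ → ∇^ m W k ≡ ∇^ m W′ k
∇^-cong m {W} {W′} k W≗ = ∑ℤ-cong (suc m) (λ i _ → cong (λ z → altSign i ℤ.* + ((m C i) ℕ.* z)) (lagged≡ i))
  where
  lagged≡ : ∀ i → lagged W k i ≡ lagged W′ k i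
  lagged≡ i with i ≤ᵇ k
  ... | true = W≗ (k ∸ i)
  ... | false = refl

∇^-⊕ : ∀ m f g k → ∇^ m (f ⊕ g) k ≡ ∇^ m f k ℤ.+ ∇^ m g k
∇^-⊕ m f g k = trans (∑ℤ-cong (suc m) (λ i _ → termwise i)) (∑ℤ-distrib-+ (suc m) (term f) (term g))
  where
  term : (ℕ → ℕ) → ℕ → ℤ
  term V i = altSign i ℤ.* + ((m C i) ℕ.* lagged V k i)
  lagged-⊕ : ∀ i → lagged (f ⊕ g) k i ≡ lagged f k i ℕ.+ lagged g k i
  lagged-⊕ i with i ≤ᵇ k
  ... | true = refl
  ... | false = refl
  distrib : ∀ s x y → s ℤ.* (x ℤ.+ y) ≡ s ℤ.* x ℤ.+ s ℤ.* y
  distrib = solve-∀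
  termwise : ∀ i → term (f ⊕ g) i ≡ term f i ℤ.+ term g i
  termwise i = trans (cong (λ z → altSign i ℤ.* + z)
                           (trans (cong ((m C i) ℕ.*_) (lagged-⊕ i)) (ℕP.*-distribˡ-+ (m C i) (lagged f k i) (lagged g k i))))
                     (distrib (altSign i) (+ ((m C i) ℕ.* lagged f k i)) (+ ((m C i) ℕ.* lagged g k i)))

∇^-partialSums : ∀ m g k → ∇^ (suc m) (partialSums g) k ≡ ∇^ m g k
∇^-partialSums m g k = begin
  ∇^ (suc m) (partialSums g) k                ≡⟨ ∇^-suc m (partialSums g) k ⟩
  ∇^ m (partialSums g) k ℤ.- ∇^ m G′ k
    ≡⟨ cong (ℤ._- ∇^ m G′ k) (trans (∇^-cong m k (partialSums-⊕-shift g)) (∇^-⊕ m g G′ k)) ⟩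
  (∇^ m g k ℤ.+ ∇^ m G′ k) ℤ.- ∇^ m G′ k      ≡⟨ cancel (∇^ m g k) (∇^ m G′ k) ⟩
  ∇^ m g k ∎
  where
  open ≡-Reasoning
  G′ = shift (partialSums g)
  cancel : ∀ a b → (a ℤ.+ b) ℤ.- b ≡ a
  cancel = solve-∀

∇^-partialSums^ : ∀ m g k → ∇^ m (partialSums^ m g) k ≡ + g k
∇^-partialSums^ zero g k = trans (ℤP.+-identityʳ _) (trans (ℤP.*-identityˡ _) (cong +_ (ℕP.+-identityʳ (g k))))
∇^-partialSums^ (suc m) g k = trans (∇^-partialSums m (partialSums^ m g) k) (∇^-partialSums^ m g k)

-- The polynomial G₁

coeff-polyAdd : ∀ p q k → coeff (polyAdd p q) k ≡ coeff p k + coeff q k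
coeff-polyAdd [] q k = refl
coeff-polyAdd (a ∷ p) [] zero = sym (ℕP.+-identityʳ a)
coeff-polyAdd (a ∷ p) [] (suc k) = sym (ℕP.+-identityʳ _)
coeff-polyAdd (a ∷ p) (b ∷ q) zero = refl
coeff-polyAdd (a ∷ p) (b ∷ q) (suc k) = coeff-polyAdd p q k

coeff-map-* : ∀ a q k → coeff (List.map (a *_) q) k ≡ a * coeff q k
coeff-map-* a [] k = sym (ℕP.*-zeroʳ a)
coeff-map-* a (b ∷ q) zero = refl
coeff-map-* a (b ∷ q) (suc k) = coeff-map-* a q k

coeff-polyMul : ∀ p q → coeff (polyMul p q) ≗ coeff p ⊛ coeff q
coeff-polyMul [] q k = sym (∑ℕ-zero (suc k))
coeff-polyMul (a ∷ p) q zero =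
  trans (coeff-polyAdd (List.map (a *_) q) (0 ∷ polyMul p q) 0) (cong (_+ 0) (coeff-map-* a q 0))
coeff-polyMul (a ∷ p) q (suc k) = trans (coeff-polyAdd (List.map (a *_) q) (0 ∷ polyMul p q) (suc k))
  (cong₂ _+_ (coeff-map-* a q (suc k)) (coeff-polyMul p q k))

coeff-geomPoly : ∀ m → coeff (geomPoly m) ≗ geometric (suc m)
coeff-geomPoly m = coeff-replicate (suc m)
  where
  coeff-replicate : ∀ n k → coeff (List.replicate n 1) k ≡ geometric n k
  coeff-replicate zero k = refl
  coeff-replicate (suc n) zero = refl
  coeff-replicate (suc n) (suc k) = coeff-replicate n k

coeff-G₁ : ∀ {r} (ns : Vec ℕ r) → coeff (G₁ ns) ≗ G₁-series ns
coeff-G₁ [] zero = refl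
coeff-G₁ [] (suc k) = refl
coeff-G₁ (m ∷ ns) k = trans (coeff-polyMul (geomPoly m) (G₁ ns) k) (⊛-cong (coeff-geomPoly m) (coeff-G₁ ns) k)

G₁-series-0 : ∀ {r} (ns : Vec ℕ r) → G₁-series ns 0 ≡ 1
G₁-series-0 [] = refl
G₁-series-0 (m ∷ ns) = trans (ℕP.+-identityʳ _) (trans (ℕP.+-identityʳ _) (G₁-series-0 ns))

G₁-series-1 : ∀ {r} (ns : Vec ℕ r) → (∀ i → 1 ℕ.≤ lookup ns i) → G₁-series ns 1 ≡ r
G₁-series-1 [] _ = refl
G₁-series-1 (zero ∷ ns) 1≤ns with 1≤ns fzero
... | ()
G₁-series-1 {suc r} (suc m ∷ ns) 1≤ns =
  trans (cong₂ _+_ (ℕP.+-identityʳ (G₁-series ns 1)) (trans (ℕP.+-identityʳ _) (trans (ℕP.+-identityʳ _) (G₁-series-0 ns))))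
        (trans (cong (_+ 1) (G₁-series-1 ns (λ i → 1≤ns (fsuc i)))) (ℕP.+-comm r 1))

Palindromic : ℕ → (ℕ → ℕ) → Set
Palindromic d f = (∀ k → d ℕ.< k → f k ≡ 0) × (∀ k → k ℕ.≤ d → f k ≡ f (d ∸ k))

∑ℕ-split : ∀ a c (h : ℕ → ℕ) → ∑ℕ (a + c) h ≡ ∑ℕ a h + ∑ℕ c (λ i → h (a + i))
∑ℕ-split zero c h = refl
∑ℕ-split (suc a) c h = trans (cong (h 0 ℕ.+_) (∑ℕ-split a c (λ i → h (suc i)))) (sym (ℕP.+-assoc (h 0) _ _))

∑ℕ-vanishing-tail : ∀ a c (h : ℕ → ℕ) → (∀ i → a ℕ.≤ i → h i ≡ 0) → ∑ℕ (a + c) h ≡ ∑ℕ a h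
∑ℕ-vanishing-tail a c h h≡0 = trans (∑ℕ-split a c h)
  (trans (cong (∑ℕ a h ℕ.+_) (trans (∑ℕ-cong c (λ i _ → h≡0 (a + i) (ℕP.m≤m+n a i))) (∑ℕ-zero c))) (ℕP.+-identityʳ _))

indicator : Bool → ℕ
indicator true = 1
indicator false = 0

∑ℕ-indicator : ∀ N t (G : ℕ → ℕ) → t ℕ.< N → ∑ℕ N (λ j → G j * indicator (j ≡ᵇ t)) ≡ G t
∑ℕ-indicator (suc N) zero G _ =
  trans (cong₂ _+_ (ℕP.*-identityʳ (G 0)) (trans (∑ℕ-cong N (λ j _ → ℕP.*-zeroʳ (G (suc j)))) (∑ℕ-zero N))) (ℕP.+-identityʳ _)
∑ℕ-indicator (suc N) (suc t) G (s≤s t<N) =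
  trans (cong (_+ ∑ℕ N (λ j → G (suc j) * indicator (j ≡ᵇ t))) (ℕP.*-zeroʳ (G 0))) (∑ℕ-indicator N t (λ j → G (suc j)) t<N)

∑ℕ-indicator-outside : ∀ N t (G : ℕ → ℕ) → N ℕ.≤ t → ∑ℕ N (λ j → G j * indicator (j ≡ᵇ t)) ≡ 0
∑ℕ-indicator-outside N t G N≤t = trans (∑ℕ-cong N (λ j j<N →
    trans (cong (λ b → G j * indicator b) (≡ᵇ-false (λ j≡t → ℕP.<-irrefl j≡t (ℕP.<-≤-trans j<N N≤t)))) (ℕP.*-zeroʳ (G j))))
  (∑ℕ-zero N)

onDiagonal : ℕ → ℕ → ℕ → ℕ
onDiagonal K i j = indicator ((i + j) ≡ᵇ K)

∑ℕ-onDiagonal : ∀ d g → Palindromic d g → ∀ K i → ∑ℕ (suc d) (λ j → g j * onDiagonal K i j) ≡ lagged g K i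
∑ℕ-onDiagonal d g g-pal K i with i ℕ.≤? K
... | yes i≤K rewrite ≤ᵇ-true i≤K =
  trans (∑ℕ-cong (suc d) (λ j _ → cong (λ b → g j * indicator b)
           (reflects-agree (≡ᵇ-reflects-≡ (i + j) K) (≡ᵇ-reflects-≡ j (K ∸ i))
              (λ e → trans (sym (ℕP.m+n∸m≡n i j)) (cong (_∸ i) e)) (λ e → trans (cong (i ℕ.+_) e) (ℕP.m+[n∸m]≡n i≤K)))))
        (∑-indicator (K ∸ i))
  where
  ∑-indicator : ∀ t → ∑ℕ (suc d) (λ j → g j * indicator (j ≡ᵇ t)) ≡ g t
  ∑-indicator t with t ℕ.≤? d
  ... | yes t≤d = ∑ℕ-indicator (suc d) t g (s≤s t≤d)
  ... | no t≰d = trans (∑ℕ-indicator-outside (suc d) t g (ℕP.≰⇒> t≰d)) (sym (proj₁ g-pal t (ℕP.≰⇒> t≰d)))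
... | no i≰K rewrite ≤ᵇ-false (ℕP.≰⇒> i≰K) =
  trans (∑ℕ-cong (suc d) (λ j _ →
           trans (cong (λ b → g j * indicator b) (≡ᵇ-false (λ e → i≰K (subst (i ℕ.≤_) e (ℕP.m≤m+n i j)))))
                 (ℕP.*-zeroʳ (g j))))
        (∑ℕ-zero (suc d))

module _ (d₁ d₂ : ℕ) (f g : ℕ → ℕ) where

  diagonalSum : ℕ → ℕ
  diagonalSum K = ∑ℕ (suc d₁) (λ i → f i * ∑ℕ (suc d₂) (λ j → g j * onDiagonal K i j))

  ⊛≡diagonalSum : Palindromic d₁ f → Palindromic d₂ g → ∀ K → (f ⊛ g) K ≡ diagonalSum K
  ⊛≡diagonalSum f-pal g-pal K = begin
    ∑ℕ (suc K) (λ i → f i * g (K ∸ i))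
      ≡⟨ ∑ℕ-cong (suc K) (λ i i≤K →
           cong (f i *_) (sym (cong (λ b → if b then g (K ∸ i) else 0) (≤ᵇ-true (ℕ.s≤s⁻¹ i≤K))))) ⟩
    ∑ℕ (suc K) h
      ≡⟨ sym (∑ℕ-vanishing-tail (suc K) d₁ h (λ i K<i → trans (cong (λ b → f i * (if b then g (K ∸ i) else 0)) (≤ᵇ-false K<i))
                                                              (ℕP.*-zeroʳ (f i)))) ⟩
    ∑ℕ (suc K + d₁) h    ≡⟨ cong (λ N → ∑ℕ N h) (cong suc (ℕP.+-comm K d₁)) ⟩
    ∑ℕ (suc d₁ + K) h    ≡⟨ ∑ℕ-vanishing-tail (suc d₁) K h (λ i d₁<i → cong (_* lagged g K i) (proj₁ f-pal i d₁<i)) ⟩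
    ∑ℕ (suc d₁) h        ≡⟨ ∑ℕ-cong (suc d₁) (λ i _ → cong (f i *_) (sym (∑ℕ-onDiagonal d₂ g g-pal K i))) ⟩
    diagonalSum K ∎
    where
    open ≡-Reasoning
    h = λ i → f i * lagged g K i

  onDiagonal-reflect : ∀ K i j → i ℕ.≤ d₁ → j ℕ.≤ d₂ → K ℕ.≤ d₁ + d₂ →
    onDiagonal K (d₁ ∸ i) (d₂ ∸ j) ≡ onDiagonal ((d₁ + d₂) ∸ K) i j
  onDiagonal-reflect K i j i≤ j≤ K≤ = cong indicator (trans (cong (_≡ᵇ K) (∸-+ i d₁ j d₂ i≤ j≤))
    (reflects-agree (≡ᵇ-reflects-≡ (D ∸ (i + j)) K) (≡ᵇ-reflects-≡ (i + j) (D ∸ K))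
      (λ e → trans (sym (ℕP.m∸[m∸n]≡n i+j≤D)) (cong (D ∸_) e))
      (λ e → trans (cong (D ∸_) e) (ℕP.m∸[m∸n]≡n K≤))))
    where
    D = d₁ + d₂
    i+j≤D : i + j ℕ.≤ D
    i+j≤D = ℕP.+-mono-≤ i≤ j≤
    ∸-+ : ∀ i d₁ j d₂ → i ℕ.≤ d₁ → j ℕ.≤ d₂ → (d₁ ∸ i) + (d₂ ∸ j) ≡ (d₁ + d₂) ∸ (i + j)
    ∸-+ zero d₁ j d₂ _ j≤ = sym (ℕP.+-∸-assoc d₁ j≤)
    ∸-+ (suc i) (suc d₁) j d₂ (s≤s i≤) j≤ = ∸-+ i d₁ j d₂ i≤ j≤

  diagonalSum-reflect : Palindromic d₁ f → Palindromic d₂ g → ∀ K → K ℕ.≤ d₁ + d₂ →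
    diagonalSum K ≡ diagonalSum ((d₁ + d₂) ∸ K)
  diagonalSum-reflect f-pal g-pal K K≤ = begin
    diagonalSum K
      ≡⟨ sym (∑ℕ-reverse′ d₁ (λ i → f i * ∑ℕ (suc d₂) (λ j → g j * onDiagonal K i j))) ⟩
    ∑ℕ (suc d₁) (λ i → f (d₁ ∸ i) * ∑ℕ (suc d₂) (λ j → g j * onDiagonal K (d₁ ∸ i) j))
      ≡⟨ ∑ℕ-cong (suc d₁) (λ i i< → cong₂ _*_ (sym (proj₂ f-pal i (ℕ.s≤s⁻¹ i<))) (inner i (ℕ.s≤s⁻¹ i<))) ⟩
    diagonalSum ((d₁ + d₂) ∸ K) ∎
    where
    open ≡-Reasoning
    inner : ∀ i → i ℕ.≤ d₁ →
      ∑ℕ (suc d₂) (λ j → g j * onDiagonal K (d₁ ∸ i) j) ≡ ∑ℕ (suc d₂) (λ j → g j * onDiagonal ((d₁ + d₂) ∸ K) i j)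
    inner i i≤ = trans (sym (∑ℕ-reverse′ d₂ (λ j → g j * onDiagonal K (d₁ ∸ i) j)))
      (∑ℕ-cong (suc d₂) (λ j j< →
         cong₂ _*_ (sym (proj₂ g-pal j (ℕ.s≤s⁻¹ j<))) (onDiagonal-reflect K i j i≤ (ℕ.s≤s⁻¹ j<) K≤)))

  diagonalSum-vanish : ∀ K → d₁ + d₂ ℕ.< K → diagonalSum K ≡ 0
  diagonalSum-vanish K D<K =
    trans (∑ℕ-cong (suc d₁) (λ i i< → trans (cong (f i *_) (inner i (ℕ.s≤s⁻¹ i<))) (ℕP.*-zeroʳ (f i)))) (∑ℕ-zero (suc d₁))
    where
    off-diagonal : ∀ i j → i ℕ.≤ d₁ → j ℕ.≤ d₂ → onDiagonal K i j ≡ 0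
    off-diagonal i j i≤ j≤ = cong indicator (≡ᵇ-false (λ e → ℕP.<-irrefl e (ℕP.≤-<-trans (ℕP.+-mono-≤ i≤ j≤) D<K)))
    inner : ∀ i → i ℕ.≤ d₁ → ∑ℕ (suc d₂) (λ j → g j * onDiagonal K i j) ≡ 0
    inner i i≤ = trans (∑ℕ-cong (suc d₂) (λ j j< →
                               trans (cong (g j *_) (off-diagonal i j i≤ (ℕ.s≤s⁻¹ j<))) (ℕP.*-zeroʳ (g j))))
                       (∑ℕ-zero (suc d₂))

  Palindromic-⊛ : Palindromic d₁ f → Palindromic d₂ g → Palindromic (d₁ + d₂) (f ⊛ g)
  Palindromic-⊛ f-pal g-pal =
    (λ k D<k → trans (⊛≡diagonalSum f-pal g-pal k) (diagonalSum-vanish k D<k)) ,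
    (λ k k≤D → trans (⊛≡diagonalSum f-pal g-pal k)
                     (trans (diagonalSum-reflect f-pal g-pal k k≤D) (sym (⊛≡diagonalSum f-pal g-pal _))))

Palindromic-geometric : ∀ m → Palindromic m (geometric (suc m))
Palindromic-geometric m = (λ k m<k → cong (λ b → if b then 1 else 0) (<ᵇ-false m<k)) ,
  (λ k k≤m → trans (cong (λ b → if b then 1 else 0) (<ᵇ-true (s≤s k≤m)))
                   (sym (cong (λ b → if b then 1 else 0) (<ᵇ-true (s≤s (ℕP.m∸n≤m m k))))))

Palindromic-δ₀ : Palindromic 0 δ₀
Palindromic-δ₀ = (λ { (suc k) _ → refl }) , (λ { zero _ → refl })

Palindromic-G₁-series : ∀ {r} (ns : Vec ℕ r) → Palindromic (total ns) (G₁-series ns)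
Palindromic-G₁-series [] = Palindromic-δ₀
Palindromic-G₁-series (m ∷ ns) =
  Palindromic-⊛ m (total ns) (geometric (suc m)) (G₁-series ns) (Palindromic-geometric m) (Palindromic-G₁-series ns)

weightCount-HasCard : ∀ {r} (ns : Vec ℕ r) k → HasCard (λ (u : Point ns) → HasWeight ns u k) (weightCount ns k)
weightCount-HasCard ns k = weightFiber ns (+ 0) k , weightFiber-unique ns (+ 0) k ,
  (λ u → mk⇔ (λ u∈ → Equivalence.from (HasWeight⇔ ns u k) (weightFiber-sound ns (+ 0) k u u∈))
             (λ hw → let (adm , w≡k) = Equivalence.to (HasWeight⇔ ns u k) hw in weightFiber-complete ns (+ 0) k u adm w≡k)) ,
  weightFiber-length ns (+ 0) k

Hodge-weightCount : ∀ {r} (ns : Vec ℕ r) k → Hodge (total ns) (weightCount ns) k ≡ + G₁-series ns k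
Hodge-weightCount ns k = trans (Hodge≡∇^ (total ns) (weightCount ns) k)
  (trans (∇^-cong (dim ns) k (weightCount≗ ns)) (∇^-partialSums^ (dim ns) (G₁-series ns) k))

corollary3p10 : (r : ℕ) (ns : Vec ℕ r) → 1 ≤ r → (∀ i → 1 ≤ lookup ns i) →
    Σ (ℕ → ℕ) λ W →
      (∀ k → HasCard (λ (u : Point ns) → HasWeight ns u k) (W k)) ×
      (∀ k → Hodge (total ns) W k ≡ + coeff (G₁ ns) k) ×
      (Hodge (total ns) W 0 ≡ + 1) ×
      (Hodge (total ns) W 1 ≡ + r) ×
      (∀ k → k ≤ total ns → Hodge (total ns) W k ≡ Hodge (total ns) W (total ns ∸ k))
corollary3p10 r ns _ 1≤ns =
  weightCount ns ,
  weightCount-HasCard ns ,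
  (λ k → trans (H k) (cong +_ (sym (coeff-G₁ ns k)))) ,
  trans (H 0) (cong +_ (G₁-series-0 ns)) ,
  trans (H 1) (cong +_ (G₁-series-1 ns 1≤ns)) ,
  (λ k k≤n → trans (H k) (trans (cong +_ (proj₂ (Palindromic-G₁-series ns) k k≤n)) (sym (H (total ns ∸ k)))))
  where
  H = Hodge-weightCount ns
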